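{- For $n\ge1$, $$\sum_{\sigma\in\mathfrak S_{n+1}}(xy)^{{\rm M}(\sigma)}\Bigl(\frac{x+y}2\Bigr)^{n-2{\rm M}(\sigma)}\alpha^{{\rm LRmin}(\sigma)-1}\beta^{{\rm RLmin}(\sigma)-1}=\sum_{k=1}^n\binom nk\frac{((\alpha+\beta)(y-x))^{n-k}}{2^{n-k}}\sum_{\sigma\in\mathfrak S_k}x^{{\rm des}(\sigma)+1}y^{{\rm asc}(\sigma)}(\alpha+\beta)^{{\rm LRmin}(\sigma)}+\Bigl(\frac{(\alpha+\beta)(y-x)}2\Bigr)^n.$$
   Context: $x,y,\alpha,\beta$ are indeterminates (or complex numbers). $\mathfrak S_m$ is the set of permutations $\sigma=\sigma_1\cdots\sigma_m$ of $[m]$. ${\rm M}(\sigma)$ = number of interior peaks ($1<i<m$, $\sigma_{i-1}<\sigma_i>\sigma_{i+1}$); ${\rm des}(\sigma)$ / ${\rm asc}(\sigma)$ = number of $1\le i<m$ with $\sigma_i>\sigma_{i+1}$ / $\sigma_i<\sigma_{i+1}$; ${\rm LRmin}(\sigma)$ (resp. ${\rm RLmin}(\sigma)$) = number of entries smaller than all entries to their left (resp. right). -}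

module Defs where

open import Data.Nat as ℕ using (ℕ; zero; suc; _<ᵇ_)
open import Data.Nat.Combinatorics using (_C_)
open import Data.Bool using (Bool; true; false; if_then_else_; _∧_)
open import Data.List using (List; []; _∷_; map; concatMap; filter; reverse; upTo; applyUpTo; foldr)
open import Data.List.Relation.Unary.Unique.DecPropositional ℕ._≟_ using (Unique; unique?)
open import Data.Integer using (+_)
open import Data.Rational using (ℚ; _+_; _*_; _-_; _/_; 0ℚ; 1ℚ)

ℕ→ℚ : ℕ → ℚ
ℕ→ℚ n = + n / 1

_^_ : ℚ → ℕ → ℚ
q ^ zero = 1ℚ
q ^ suc n = q * (q ^ n)

infixr 8 _^_

sumℚ : List ℚ → ℚ
sumℚ = foldr _+_ 0ℚ

words : ℕ → ℕ → List (List ℕ)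
words m zero = [] ∷ []
words m (suc k) = concatMap (λ w → map (λ a → a ∷ w) (applyUpTo suc m)) (words m k)

-- 𝔖 m : all permutations of [m] = {1,…,m}, in one-line notation σ₁⋯σₘ
-- (words of length m over [m] with pairwise distinct letters)
𝔖 : ℕ → List (List ℕ)
𝔖 m = filter unique? (words m m)

peaks : List ℕ → ℕ
peaks (a ∷ b ∷ c ∷ l) = (if (a <ᵇ b) ∧ (c <ᵇ b) then 1 else 0) ℕ.+ peaks (b ∷ c ∷ l)
peaks _ = 0

des : List ℕ → ℕ
des (a ∷ b ∷ l) = (if b <ᵇ a then 1 else 0) ℕ.+ des (b ∷ l)
des _ = 0

asc : List ℕ → ℕ
asc (a ∷ b ∷ l) = (if a <ᵇ b then 1 else 0) ℕ.+ asc (b ∷ l)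
asc _ = 0

lrminFrom : ℕ → List ℕ → ℕ
lrminFrom m [] = 0
lrminFrom m (b ∷ l) = if b <ᵇ m then suc (lrminFrom b l) else lrminFrom m l

LRmin : List ℕ → ℕ
LRmin [] = 0
LRmin (a ∷ l) = suc (lrminFrom a l)

RLmin : List ℕ → ℕ
RLmin σ = LRmin (reverse σ)

½ : ℚ
½ = + 1 / 2

LHS : ℕ → ℚ → ℚ → ℚ → ℚ → ℚ
LHS n x y α β = sumℚ (map (λ σ →
    ((x * y) ^ peaks σ) * (((x + y) * ½) ^ (n ℕ.∸ 2 ℕ.* peaks σ))
      * (α ^ (LRmin σ ℕ.∸ 1)) * (β ^ (RLmin σ ℕ.∸ 1)))
  (𝔖 (suc n)))

inner : ℕ → ℚ → ℚ → ℚ → ℚ → ℚ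
inner k x y α β = sumℚ (map (λ σ →
    (x ^ suc (des σ)) * (y ^ asc σ) * ((α + β) ^ LRmin σ)) (𝔖 k))

RHS : ℕ → ℚ → ℚ → ℚ → ℚ → ℚ
RHS n x y α β =
  sumℚ (map (λ k →
      ℕ→ℚ (n C k) * (((α + β) * (y - x)) ^ (n ℕ.∸ k)) * (½ ^ (n ℕ.∸ k))
        * inner k x y α β)
    (applyUpTo suc n))
  + ((α + β) * (y - x) * ½) ^ n

{-# OPTIONS --safe #-}
module Submission where

-- Write u = xy, h = (x + y)/2, t = α + β, and let D be the derivation with D x = D y = xy, so that
-- D u = 2uh and D h = u. Insert n + 2 into σ ∈ 𝔖 (n + 1): in front it becomes a new left-to-right
-- minimum (factor α), at the end a new right-to-left minimum (factor β); of the n interior gaps the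
-- 2 M(σ) next to a peak keep the number of peaks and the others raise it by one. Hence the left side
-- satisfies L (n + 1) = t h L n + D (L n). The same insertion gives B (k + 1) = t x B k + D (B k) for
-- B 0 = 1 and the inner sums B k, k ≥ 1; as D kills s = t (y − x)/2, Pascal's rule shows that the
-- right side Σ C(n, k) s ^ (n − k) B k satisfies the same recurrence, because t h = s + t x.
-- D is realised by dual numbers, so the identity is proved over every commutative ring containing
-- 1/2, and the induction step uses the identity both over R and over R[ε].

open import Algebra using (CommutativeRing)
open import Level using (0ℓ)

module Permutations where

  open import Defs using (words; 𝔖)
  open import Data.Nat as ℕ using (ℕ; zero; suc; _≤_; _<_; z≤n; s≤s; _≟_)
  open import Data.Nat.Properties as ℕ using (≤-refl; ≤-trans; <-irrefl; m≤n⇒m≤1+n; suc-injective)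
  open import Data.List using (List; []; _∷_; map; concatMap; applyUpTo; length; _++_)
  open import Data.List.Membership.Propositional using (_∈_; _∉_; find; lose)
  open import Data.List.Membership.Propositional.Properties
    using (∈-map⁺; ∈-map⁻; ∈-concatMap⁺; ∈-concatMap⁻; ∈-applyUpTo⁺; ∈-applyUpTo⁻; ∈-filter⁺; ∈-filter⁻; ∈-∃++; ∈-++⁺ˡ)
  open import Data.List.Membership.DecPropositional ℕ._≟_ using (_∈?_)
  open import Data.List.Relation.Unary.All as All using (All; []; _∷_)
  open import Data.List.Relation.Unary.All.Properties as All using (¬Any⇒All¬; All¬⇒¬Any)
  open import Data.List.Relation.Unary.Any using (here; there)
  open import Data.List.Relation.Unary.Unique.Propositional using (Unique; []; _∷_)
  import Data.List.Relation.Unary.Unique.Propositional.Properties as Unique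
  open import Data.List.Relation.Unary.Unique.DecPropositional ℕ._≟_ using (unique?)
  open import Data.List.Relation.Binary.Permutation.Propositional using (_↭_)
  open import Data.List.Relation.Binary.BagAndSetEquality using (∼bag⇒↭)
  open import Data.List.Membership.Propositional.Properties.WithK using (unique∧set⇒bag)
  open import Data.Product using (∃; ∃₂; _×_; _,_; proj₁; proj₂)
  open import Data.Empty using (⊥; ⊥-elim)
  open import Relation.Nullary using (yes; no)
  open import Relation.Binary.PropositionalEquality using (_≡_; refl; sym; trans; cong; subst)
  open import Function using (_∘_)
  open import Function.Bundles using (mk⇔)

  InRange : ℕ → ℕ → Set
  InRange m a = 0 < a × a ≤ m

  IsPerm : ℕ → List ℕ → Set
  IsPerm m τ = Unique τ × length τ ≡ m × All (InRange m) τ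

  ∈-words⁻ : ∀ m k {τ} → τ ∈ words m k → length τ ≡ k × All (InRange m) τ
  ∈-words⁻ m zero (here refl) = refl , []
  ∈-words⁻ m (suc k) p
    with w , w∈ , τ∈ ← find (∈-concatMap⁻ (λ w → map (_∷ w) (applyUpTo suc m)) {xs = words m k} p)
    with _ , a∈ , refl ← ∈-map⁻ (_∷ w) τ∈
    with _ , i<m , refl ← ∈-applyUpTo⁻ suc a∈
    with lw , aw ← ∈-words⁻ m k w∈
    = cong suc lw , (s≤s z≤n , i<m) ∷ aw

  ∈-words⁺ : ∀ m k τ → length τ ≡ k → All (InRange m) τ → τ ∈ words m k
  ∈-words⁺ m zero [] refl [] = here refl
  ∈-words⁺ m (suc k) (suc i ∷ w) eq ((_ , i<m) ∷ aw) =
    ∈-concatMap⁺ (λ w → map (_∷ w) (applyUpTo suc m))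
      (lose (∈-words⁺ m k w (suc-injective eq) aw) (∈-map⁺ (_∷ w) (∈-applyUpTo⁺ suc i<m)))

  ∈-𝔖⁻ : ∀ m {τ} → τ ∈ 𝔖 m → IsPerm m τ
  ∈-𝔖⁻ m p with w∈ , u ← ∈-filter⁻ unique? {xs = words m m} p
           with l , a ← ∈-words⁻ m m w∈ = u , l , a

  ∈-𝔖⁺ : ∀ m τ → IsPerm m τ → τ ∈ 𝔖 m
  ∈-𝔖⁺ m τ (u , l , a) = ∈-filter⁺ unique? (∈-words⁺ m m τ l a) u

  length-++-∷ : ∀ (l₁ : List ℕ) {x} l₂ → length (l₁ ++ x ∷ l₂) ≡ suc (length (l₁ ++ l₂))
  length-++-∷ [] l₂ = refl
  length-++-∷ (_ ∷ l₁) l₂ = cong suc (length-++-∷ l₁ l₂)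

  All-++-∷⁻ : ∀ {P : ℕ → Set} l₁ {x l₂} → All P (l₁ ++ x ∷ l₂) → All P (l₁ ++ l₂) × P x
  All-++-∷⁻ l₁ p with p₁ , px ∷ p₂ ← All.++⁻ l₁ p = All.++⁺ p₁ p₂ , px

  All-++-∷⁺ : ∀ {P : ℕ → Set} l₁ {x l₂} → All P (l₁ ++ l₂) → P x → All P (l₁ ++ x ∷ l₂)
  All-++-∷⁺ l₁ p px with p₁ , p₂ ← All.++⁻ l₁ p = All.++⁺ p₁ (px ∷ p₂)

  Unique-++-∷⁻ : ∀ (l₁ : List ℕ) {x l₂} → Unique (l₁ ++ x ∷ l₂) → Unique (l₁ ++ l₂) × x ∉ l₁ ++ l₂
  Unique-++-∷⁻ [] (x∉ ∷ u) = u , All¬⇒¬Any x∉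
  Unique-++-∷⁻ (b ∷ l₁) (b∉ ∷ u)
    with u′ , x∉ ← Unique-++-∷⁻ l₁ u
    with b∉′ , b≢x ← All-++-∷⁻ l₁ b∉
    = b∉′ ∷ u′ , λ { (here refl) → b≢x refl ; (there q) → x∉ q }

  Unique-++-∷⁺ : ∀ (l₁ : List ℕ) {x l₂} → Unique (l₁ ++ l₂) → x ∉ l₁ ++ l₂ → Unique (l₁ ++ x ∷ l₂)
  Unique-++-∷⁺ [] u x∉ = ¬Any⇒All¬ _ x∉ ∷ u
  Unique-++-∷⁺ (b ∷ l₁) (b∉ ∷ u) x∉ =
    All-++-∷⁺ l₁ b∉ (λ b≡x → x∉ (here (sym b≡x))) ∷ Unique-++-∷⁺ l₁ u (x∉ ∘ there)

  narrow : ∀ {k} τ → All (InRange (suc k)) τ → suc k ∉ τ → All (InRange k) τ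
  narrow [] _ _ = []
  narrow (a ∷ τ) ((0<a , a≤) ∷ p) k∉ =
    (0<a , ℕ.≤-pred (ℕ.≤∧≢⇒< a≤ (λ a≡k → k∉ (here (sym a≡k))))) ∷ narrow τ p (k∉ ∘ there)

  widen : ∀ {k τ} → All (InRange k) τ → All (InRange (suc k)) τ
  widen = All.map (λ (0<a , a≤k) → 0<a , m≤n⇒m≤1+n a≤k)

  ∈-𝔖⇒< : ∀ m {σ} → σ ∈ 𝔖 m → All (_< suc m) σ
  ∈-𝔖⇒< m p = All.map (λ (_ , a≤m) → s≤s a≤m) (proj₂ (proj₂ (∈-𝔖⁻ m p)))

  suc∉ : ∀ {k τ} → All (InRange k) τ → suc k ∉ τ
  suc∉ ((_ , k<k) ∷ _) (here refl) = <-irrefl refl k<k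
  suc∉ (_ ∷ p) (there q) = suc∉ p q

  removeMax : ∀ {k τ} → Unique τ → All (InRange (suc k)) τ → suc k ∈ τ →
              ∃₂ λ l₁ l₂ → τ ≡ l₁ ++ suc k ∷ l₂ × Unique (l₁ ++ l₂) × All (InRange k) (l₁ ++ l₂)
  removeMax {k} u p k∈ with l₁ , l₂ , refl ← ∈-∃++ k∈
    with u′ , k∉ ← Unique-++-∷⁻ l₁ u
    = l₁ , l₂ , refl , u′ , narrow (l₁ ++ l₂) (proj₁ (All-++-∷⁻ l₁ p)) k∉

  unique⇒length≤ : ∀ k (τ : List ℕ) → Unique τ → All (InRange k) τ → length τ ≤ k
  unique⇒length≤ zero [] _ _ = z≤n
  unique⇒length≤ zero (a ∷ τ) _ ((0<a , a≤0) ∷ _) = ⊥-elim (<-irrefl refl (ℕ.<-≤-trans 0<a a≤0))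
  unique⇒length≤ (suc k) τ u p with suc k ∈? τ
  ... | no k∉ = m≤n⇒m≤1+n (unique⇒length≤ k τ u (narrow τ p k∉))
  ... | yes k∈ with l₁ , l₂ , refl , u′ , p′ ← removeMax u p k∈ =
    ≤-trans (ℕ.≤-reflexive (length-++-∷ l₁ l₂)) (s≤s (unique⇒length≤ k (l₁ ++ l₂) u′ p′))

  insertions : ℕ → List ℕ → List (List ℕ)
  insertions a [] = (a ∷ []) ∷ []
  insertions a (b ∷ l) = (a ∷ b ∷ l) ∷ map (b ∷_) (insertions a l)

  ∈-insertions⁺ : ∀ a l₁ l₂ → l₁ ++ a ∷ l₂ ∈ insertions a (l₁ ++ l₂)
  ∈-insertions⁺ a [] [] = here refl
  ∈-insertions⁺ a [] (b ∷ l₂) = here refl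
  ∈-insertions⁺ a (b ∷ l₁) l₂ = there (∈-map⁺ (b ∷_) (∈-insertions⁺ a l₁ l₂))

  ∈-insertions⁻ : ∀ a σ {τ} → τ ∈ insertions a σ → ∃₂ λ l₁ l₂ → σ ≡ l₁ ++ l₂ × τ ≡ l₁ ++ a ∷ l₂
  ∈-insertions⁻ a [] (here refl) = [] , [] , refl , refl
  ∈-insertions⁻ a (b ∷ σ) (here refl) = [] , b ∷ σ , refl , refl
  ∈-insertions⁻ a (b ∷ σ) (there p)
    with τ′ , τ′∈ , refl ← ∈-map⁻ (b ∷_) p
    with l₁ , l₂ , refl , refl ← ∈-insertions⁻ a σ τ′∈
    = b ∷ l₁ , l₂ , refl , refl

  ∈-𝔖-suc⁻ : ∀ m {τ} → τ ∈ 𝔖 (suc m) → τ ∈ concatMap (insertions (suc m)) (𝔖 m)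
  ∈-𝔖-suc⁻ m {τ} p with u , len , inRange ← ∈-𝔖⁻ (suc m) p with suc m ∈? τ
  ... | no m∉ = ⊥-elim (<-irrefl refl (≤-trans (ℕ.≤-reflexive (sym len)) (unique⇒length≤ m τ u (narrow τ inRange m∉))))
  ... | yes m∈ with l₁ , l₂ , refl , u′ , inRange′ ← removeMax u inRange m∈ =
    ∈-concatMap⁺ (insertions (suc m))
      (lose (∈-𝔖⁺ m (l₁ ++ l₂) (u′ , suc-injective (trans (sym (length-++-∷ l₁ l₂)) len) , inRange′))
            (∈-insertions⁺ (suc m) l₁ l₂))

  ∈-𝔖-suc⁺ : ∀ m {τ} → τ ∈ concatMap (insertions (suc m)) (𝔖 m) → τ ∈ 𝔖 (suc m)
  ∈-𝔖-suc⁺ m p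
    with σ , σ∈ , τ∈ ← find (∈-concatMap⁻ (insertions (suc m)) {xs = 𝔖 m} p)
    with l₁ , l₂ , refl , refl ← ∈-insertions⁻ (suc m) σ τ∈
    with u , len , inRange ← ∈-𝔖⁻ m σ∈
    = ∈-𝔖⁺ (suc m) (l₁ ++ suc m ∷ l₂)
        (Unique-++-∷⁺ l₁ u (suc∉ inRange) , trans (length-++-∷ l₁ l₂) (cong suc len) ,
         All-++-∷⁺ l₁ (widen inRange) (s≤s z≤n , ≤-refl))

  concatMap-unique : ∀ {A B : Set} (f : A → List B) {xs} → Unique xs →
    (∀ {x} → x ∈ xs → Unique (f x)) →
    (∀ {x y z} → x ∈ xs → y ∈ xs → z ∈ f x → z ∈ f y → x ≡ y) →
    Unique (concatMap f xs)
  concatMap-unique f [] _ _ = []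
  concatMap-unique f {x ∷ xs} (x∉ ∷ u) uf inj =
    Unique.++⁺ (uf (here refl)) (concatMap-unique f u (uf ∘ there) (λ p q → inj (there p) (there q)))
      λ (z∈fx , z∈rest) → disjoint z∈fx (find (∈-concatMap⁻ f {xs = xs} z∈rest))
    where
    disjoint : ∀ {z} → z ∈ f x → ∃ (λ y → y ∈ xs × z ∈ f y) → ⊥
    disjoint z∈fx (y , y∈ , z∈fy) = All¬⇒¬Any x∉ (subst (_∈ xs) (sym (inj (here refl) (there y∈) z∈fx z∈fy)) y∈)

  words-unique : ∀ m k → Unique (words m k)
  words-unique m zero = [] ∷ []
  words-unique m (suc k) =
    concatMap-unique (λ w → map (_∷ w) (applyUpTo suc m)) (words-unique m k)
      (λ _ → Unique.map⁺ (λ { refl → refl })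
               (Unique.applyUpTo⁺₁ suc m (λ i<j _ i≡j → <-irrefl (suc-injective i≡j) i<j)))
      λ _ _ p q → tails-equal (∈-map⁻ _ p) (∈-map⁻ _ q)
    where
    tails-equal : ∀ {P : ℕ → Set} {x y z : List ℕ} → ∃ (λ a → P a × z ≡ a ∷ x) → ∃ (λ a → P a × z ≡ a ∷ y) → x ≡ y
    tails-equal (_ , _ , refl) (_ , _ , refl) = refl

  𝔖-unique : ∀ m → Unique (𝔖 m)
  𝔖-unique m = Unique.filter⁺ unique? (words-unique m m)

  insertions-unique : ∀ a σ → a ∉ σ → Unique (insertions a σ)
  insertions-unique a [] _ = [] ∷ []
  insertions-unique a (b ∷ σ) a∉ =
    ¬Any⇒All¬ _ (λ p → head-differs (∈-map⁻ (b ∷_) p)) ∷ Unique.map⁺ (λ { refl → refl }) (insertions-unique a σ (a∉ ∘ there))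
    where
    head-differs : ∃ (λ τ → τ ∈ insertions a σ × a ∷ b ∷ σ ≡ b ∷ τ) → ⊥
    head-differs (_ , _ , refl) = a∉ (here refl)

  remove : ℕ → List ℕ → List ℕ
  remove a [] = []
  remove a (b ∷ l) with a ≟ b
  ... | yes _ = l
  ... | no _ = b ∷ remove a l

  remove-++-∷ : ∀ a (l₁ : List ℕ) l₂ → a ∉ l₁ → remove a (l₁ ++ a ∷ l₂) ≡ l₁ ++ l₂
  remove-++-∷ a [] l₂ _ with a ≟ a
  ... | yes _ = refl
  ... | no a≢a = ⊥-elim (a≢a refl)
  remove-++-∷ a (b ∷ l₁) l₂ a∉ with a ≟ b
  ... | yes refl = ⊥-elim (a∉ (here refl))
  ... | no _ = cong (b ∷_) (remove-++-∷ a l₁ l₂ (a∉ ∘ there))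

  insertions-injective : ∀ a {σ σ′ τ} → a ∉ σ → a ∉ σ′ → τ ∈ insertions a σ → τ ∈ insertions a σ′ → σ ≡ σ′
  insertions-injective a {σ} {σ′} a∉ a∉′ p q
    with l₁ , l₂ , refl , refl ← ∈-insertions⁻ a σ p
    with l₁′ , l₂′ , refl , eq ← ∈-insertions⁻ a σ′ q
    = trans (sym (remove-++-∷ a l₁ l₂ (a∉ ∘ ∈-++⁺ˡ)))
        (trans (cong (remove a) eq) (remove-++-∷ a l₁′ l₂′ (a∉′ ∘ ∈-++⁺ˡ)))

  𝔖-suc↭ : ∀ m → 𝔖 (suc m) ↭ concatMap (insertions (suc m)) (𝔖 m)
  𝔖-suc↭ m = ∼bag⇒↭ (unique∧set⇒bag (𝔖-unique (suc m)) insertions-of-𝔖-unique (mk⇔ (∈-𝔖-suc⁻ m) (∈-𝔖-suc⁺ m)))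
    where
    max∉ : ∀ {σ} → σ ∈ 𝔖 m → suc m ∉ σ
    max∉ p = suc∉ (proj₂ (proj₂ (∈-𝔖⁻ m p)))
    insertions-of-𝔖-unique : Unique (concatMap (insertions (suc m)) (𝔖 m))
    insertions-of-𝔖-unique = concatMap-unique (insertions (suc m)) (𝔖-unique m)
      (λ p → insertions-unique (suc m) _ (max∉ p))
      (λ p q → insertions-injective (suc m) (max∉ p) (max∉ q))

module InsertionStatistics where

  open import Defs using (peaks; des; asc; lrminFrom; LRmin; RLmin)
  open import Data.Nat as ℕ using (ℕ; suc; _≤_; _<_; _<ᵇ_)
  open import Data.Nat.Properties as ℕ using (<⇒≤; <ᵇ⇒<; <⇒<ᵇ; <⇒≱)
  open import Data.Bool using (true; false; if_then_else_; _∧_; T)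
  open import Data.Bool.Properties using (∧-zeroʳ)
  open import Data.List using (List; []; _∷_; map; _++_; reverse; _∷ʳ_)
  open import Data.List.Properties using (++-assoc; ++-identityʳ; unfold-reverse; reverse-++; map-++)
  open import Data.List.Relation.Unary.All as All using (All; []; _∷_)
  import Data.List.Relation.Unary.All.Properties as All
  open import Data.Product using (Σ; ∃; ∃₂; _×_; _,_)
  open import Data.Sum using (_⊎_; inj₁; inj₂)
  open import Data.Empty using (⊥; ⊥-elim)
  open import Data.Unit using (tt)
  open import Relation.Binary.PropositionalEquality
  open Permutations using (insertions)

  <ᵇ-true : ∀ {m n} → m < n → (m <ᵇ n) ≡ true
  <ᵇ-true {m} {n} m<n with m <ᵇ n in eq
  ... | true = refl
  ... | false = ⊥-elim (subst T eq (<⇒<ᵇ m<n))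

  <ᵇ-false : ∀ {m n} → n ≤ m → (m <ᵇ n) ≡ false
  <ᵇ-false {m} {n} n≤m with m <ᵇ n in eq
  ... | false = refl
  ... | true = ⊥-elim (<⇒≱ (<ᵇ⇒< m n (subst T (sym eq) tt)) n≤m)

  All-reverse⁺ : ∀ {P : ℕ → Set} l → All P l → All P (reverse l)
  All-reverse⁺ [] [] = []
  All-reverse⁺ (x ∷ l) (px ∷ pl) rewrite unfold-reverse x l = All.++⁺ (All-reverse⁺ l pl) (px ∷ [])

  reverse-∷-nonempty : ∀ (b : ℕ) l → ∃₂ λ c r → reverse (b ∷ l) ≡ c ∷ r
  reverse-∷-nonempty b l rewrite unfold-reverse b l with reverse l
  ... | [] = b , [] , refl
  ... | c ∷ r = c , r ++ b ∷ [] , refl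

  reverse-++-∷ : ∀ (l₁ : List ℕ) a l₂ → reverse (l₁ ++ a ∷ l₂) ≡ reverse l₂ ++ a ∷ reverse l₁
  reverse-++-∷ l₁ a l₂ = begin
    reverse (l₁ ++ a ∷ l₂)               ≡⟨ reverse-++ l₁ (a ∷ l₂) ⟩
    reverse (a ∷ l₂) ++ reverse l₁       ≡⟨ cong (_++ reverse l₁) (unfold-reverse a l₂) ⟩
    (reverse l₂ ∷ʳ a) ++ reverse l₁      ≡⟨ ++-assoc (reverse l₂) (a ∷ []) (reverse l₁) ⟩
    reverse l₂ ++ a ∷ reverse l₁         ∎
    where open ≡-Reasoning

  peaks-∷-max : ∀ a l → All (_< a) l → peaks (a ∷ l) ≡ peaks l
  peaks-∷-max a [] _ = refl
  peaks-∷-max a (b ∷ []) _ = refl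
  peaks-∷-max a (b ∷ c ∷ l) (b<a ∷ _) rewrite <ᵇ-false {a} {b} (<⇒≤ b<a) = refl

  peaks-∷ʳ-max : ∀ a l → All (_< a) l → peaks (l ++ a ∷ []) ≡ peaks l
  peaks-∷ʳ-max a [] _ = refl
  peaks-∷ʳ-max a (b ∷ []) _ = refl
  peaks-∷ʳ-max a (b ∷ c ∷ []) (_ ∷ c<a ∷ _) rewrite <ᵇ-false {a} {c} (<⇒≤ c<a) | ∧-zeroʳ (b <ᵇ c) = refl
  peaks-∷ʳ-max a (b ∷ c ∷ d ∷ l) (_ ∷ p) =
    cong ((if (b <ᵇ c) ∧ (d <ᵇ c) then 1 else 0) ℕ.+_) (peaks-∷ʳ-max a (c ∷ d ∷ l) p)

  des-∷-max : ∀ a b l → b < a → des (a ∷ b ∷ l) ≡ suc (des (b ∷ l))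
  des-∷-max a b l b<a rewrite <ᵇ-true b<a = refl

  asc-∷-max : ∀ a b l → b < a → asc (a ∷ b ∷ l) ≡ asc (b ∷ l)
  asc-∷-max a b l b<a rewrite <ᵇ-false {a} {b} (<⇒≤ b<a) = refl

  des-∷ʳ-max : ∀ a l → All (_< a) l → des (l ++ a ∷ []) ≡ des l
  des-∷ʳ-max a [] _ = refl
  des-∷ʳ-max a (b ∷ []) (b<a ∷ _) rewrite <ᵇ-false {a} {b} (<⇒≤ b<a) = refl
  des-∷ʳ-max a (b ∷ c ∷ l) (_ ∷ p) = cong ((if c <ᵇ b then 1 else 0) ℕ.+_) (des-∷ʳ-max a (c ∷ l) p)

  asc-∷ʳ-max : ∀ a b l → All (_< a) (b ∷ l) → asc ((b ∷ l) ++ a ∷ []) ≡ suc (asc (b ∷ l))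
  asc-∷ʳ-max a b [] (b<a ∷ _) rewrite <ᵇ-true b<a = refl
  asc-∷ʳ-max a b (c ∷ l) (_ ∷ p) =
    trans (cong ((if b <ᵇ c then 1 else 0) ℕ.+_) (asc-∷ʳ-max a c l p)) (ℕ.+-suc _ _)

  lrminFrom-++-max : ∀ {a} m l₁ l₂ → m ≤ a → All (_< a) l₁ → lrminFrom m (l₁ ++ a ∷ l₂) ≡ lrminFrom m (l₁ ++ l₂)
  lrminFrom-++-max {a} m [] l₂ m≤a [] rewrite <ᵇ-false {a} {m} m≤a = refl
  lrminFrom-++-max m (b ∷ l₁) l₂ m≤a (b<a ∷ p) with b <ᵇ m
  ... | true = cong suc (lrminFrom-++-max b l₁ l₂ (<⇒≤ b<a) p)
  ... | false = lrminFrom-++-max m l₁ l₂ m≤a p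

  LRmin-++-max : ∀ {a} b l₁ l₂ → All (_< a) (b ∷ l₁) → LRmin ((b ∷ l₁) ++ a ∷ l₂) ≡ LRmin ((b ∷ l₁) ++ l₂)
  LRmin-++-max b l₁ l₂ (b<a ∷ p) = cong suc (lrminFrom-++-max b l₁ l₂ (<⇒≤ b<a) p)

  LRmin-∷ʳ-max : ∀ {a} b l → All (_< a) (b ∷ l) → LRmin ((b ∷ l) ++ a ∷ []) ≡ LRmin (b ∷ l)
  LRmin-∷ʳ-max b l p = trans (LRmin-++-max b l [] p) (cong LRmin (++-identityʳ (b ∷ l)))

  LRmin-∷-max : ∀ {a} b l → All (_< a) (b ∷ l) → LRmin (a ∷ b ∷ l) ≡ suc (LRmin (b ∷ l))
  LRmin-∷-max b l (b<a ∷ _) rewrite <ᵇ-true b<a = refl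

  RLmin-++-max : ∀ {a} l₁ d l₂ → All (_< a) (d ∷ l₂) → RLmin (l₁ ++ a ∷ d ∷ l₂) ≡ RLmin (l₁ ++ d ∷ l₂)
  RLmin-++-max {a} l₁ d l₂ p with c , r , eq ← reverse-∷-nonempty d l₂ = begin
    LRmin (reverse (l₁ ++ a ∷ d ∷ l₂))      ≡⟨ cong LRmin (reverse-++-∷ l₁ a (d ∷ l₂)) ⟩
    LRmin (reverse (d ∷ l₂) ++ a ∷ reverse l₁) ≡⟨ cong (λ z → LRmin (z ++ a ∷ reverse l₁)) eq ⟩
    LRmin ((c ∷ r) ++ a ∷ reverse l₁)       ≡⟨ LRmin-++-max c r (reverse l₁) (subst (All (_< a)) eq (All-reverse⁺ (d ∷ l₂) p)) ⟩
    LRmin ((c ∷ r) ++ reverse l₁)           ≡⟨ cong (λ z → LRmin (z ++ reverse l₁)) (sym eq) ⟩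
    LRmin (reverse (d ∷ l₂) ++ reverse l₁)  ≡⟨ cong LRmin (reverse-++ l₁ (d ∷ l₂)) ⟨
    LRmin (reverse (l₁ ++ d ∷ l₂))          ∎
    where open ≡-Reasoning

  RLmin-∷-max : ∀ {a} b l → All (_< a) (b ∷ l) → RLmin (a ∷ b ∷ l) ≡ RLmin (b ∷ l)
  RLmin-∷-max {a} b l p with c , r , eq ← reverse-∷-nonempty b l = begin
    LRmin (reverse (a ∷ b ∷ l))       ≡⟨ cong LRmin (unfold-reverse a (b ∷ l)) ⟩
    LRmin (reverse (b ∷ l) ++ a ∷ []) ≡⟨ cong (λ z → LRmin (z ++ a ∷ [])) eq ⟩
    LRmin ((c ∷ r) ++ a ∷ [])         ≡⟨ LRmin-∷ʳ-max c r (subst (All (_< a)) eq (All-reverse⁺ (b ∷ l) p)) ⟩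
    LRmin (c ∷ r)                     ≡⟨ cong LRmin eq ⟨
    LRmin (reverse (b ∷ l))           ∎
    where open ≡-Reasoning

  RLmin-∷ʳ-max : ∀ {a} b l → All (_< a) (b ∷ l) → RLmin ((b ∷ l) ++ a ∷ []) ≡ suc (RLmin (b ∷ l))
  RLmin-∷ʳ-max {a} b l p with c , r , eq ← reverse-∷-nonempty b l = begin
    LRmin (reverse ((b ∷ l) ++ a ∷ [])) ≡⟨ cong LRmin (reverse-++-∷ (b ∷ l) a []) ⟩
    LRmin (a ∷ reverse (b ∷ l))         ≡⟨ cong (λ z → LRmin (a ∷ z)) eq ⟩
    LRmin (a ∷ c ∷ r)                   ≡⟨ LRmin-∷-max c r (subst (All (_< a)) eq (All-reverse⁺ (b ∷ l) p)) ⟩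
    suc (LRmin (c ∷ r))                 ≡⟨ cong (λ z → suc (LRmin z)) eq ⟨
    suc (LRmin (reverse (b ∷ l)))       ∎
    where open ≡-Reasoning

  RLmin-∷-nonzero : ∀ b l → RLmin (b ∷ l) ≡ suc (RLmin (b ∷ l) ℕ.∸ 1)
  RLmin-∷-nonzero b l with c , r , eq ← reverse-∷-nonempty b l rewrite eq = refl

  interiorInsertions : ℕ → List ℕ → List (List ℕ)
  interiorInsertions a [] = []
  interiorInsertions a (b ∷ []) = []
  interiorInsertions a (b ∷ c ∷ l) = (b ∷ a ∷ c ∷ l) ∷ map (b ∷_) (interiorInsertions a (c ∷ l))

  insertions-∷ : ∀ a b l → insertions a (b ∷ l) ≡ (a ∷ b ∷ l) ∷ (interiorInsertions a (b ∷ l) ++ ((b ∷ l) ++ a ∷ []) ∷ [])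
  insertions-∷ a b [] = refl
  insertions-∷ a b (c ∷ l) = cong ((a ∷ b ∷ c ∷ l) ∷_) (begin
    map (b ∷_) (insertions a (c ∷ l))
      ≡⟨ cong (map (b ∷_)) (insertions-∷ a c l) ⟩
    map (b ∷_) (((a ∷ c ∷ l) ∷ interiorInsertions a (c ∷ l)) ++ ((c ∷ l) ++ a ∷ []) ∷ [])
      ≡⟨ map-++ (b ∷_) ((a ∷ c ∷ l) ∷ interiorInsertions a (c ∷ l)) (((c ∷ l) ++ a ∷ []) ∷ []) ⟩
    interiorInsertions a (b ∷ c ∷ l) ++ ((b ∷ c ∷ l) ++ a ∷ []) ∷ [] ∎)
    where open ≡-Reasoning

  interiorInsertions-∷ : ∀ a d l → All (λ τ → ∃ λ r → τ ≡ d ∷ r) (interiorInsertions a (d ∷ l))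
  interiorInsertions-∷ a d [] = []
  interiorInsertions-∷ a d (e ∷ l) = (_ , refl) ∷ All.map⁺ (All.tabulate (λ _ → _ , refl))

  InteriorSplit : ℕ → List ℕ → List ℕ → Set
  InteriorSplit a σ τ = Σ ℕ λ b → Σ (List ℕ) λ l₁ → Σ ℕ λ d → Σ (List ℕ) λ l₂ →
                          σ ≡ (b ∷ l₁) ++ d ∷ l₂ × τ ≡ (b ∷ l₁) ++ a ∷ d ∷ l₂

  interiorInsertions-split : ∀ a σ → All (InteriorSplit a σ) (interiorInsertions a σ)
  interiorInsertions-split a [] = []
  interiorInsertions-split a (b ∷ []) = []
  interiorInsertions-split a (b ∷ c ∷ l) =
    (b , [] , c , l , refl , refl) ∷ All.map⁺ (All.map extend (interiorInsertions-split a (c ∷ l)))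
    where
    extend : ∀ {τ} → InteriorSplit a (c ∷ l) τ → InteriorSplit a (b ∷ c ∷ l) (b ∷ τ)
    extend (b′ , l₁ , d , l₂ , refl , refl) = b , b′ ∷ l₁ , d , l₂ , refl , refl

  interiorInsertions-LRmin-RLmin : ∀ a σ → All (_< a) σ →
    All (λ τ → LRmin τ ≡ LRmin σ × RLmin τ ≡ RLmin σ) (interiorInsertions a σ)
  interiorInsertions-LRmin-RLmin a σ p = All.map preserved (interiorInsertions-split a σ)
    where
    preserved : ∀ {τ} → InteriorSplit a σ τ → LRmin τ ≡ LRmin σ × RLmin τ ≡ RLmin σ
    preserved (b , l₁ , d , l₂ , refl , refl) with p₁ , p₂ ← All.++⁻ (b ∷ l₁) p =
      LRmin-++-max b l₁ (d ∷ l₂) p₁ , RLmin-++-max (b ∷ l₁) d l₂ p₂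

  isPeak : ℕ → ℕ → List ℕ → ℕ
  isPeak b c [] = 0
  isPeak b c (d ∷ _) = if (b <ᵇ c) ∧ (d <ᵇ c) then 1 else 0

  peaks-∷-∷ : ∀ b c σ → peaks (b ∷ c ∷ σ) ≡ isPeak b c σ ℕ.+ peaks (c ∷ σ)
  peaks-∷-∷ b c [] = refl
  peaks-∷-∷ b c (d ∷ σ) = refl

  isPeak-0∨1 : ∀ b c σ → isPeak b c σ ≡ 0 ⊎ isPeak b c σ ≡ 1
  isPeak-0∨1 b c [] = inj₁ refl
  isPeak-0∨1 b c (d ∷ σ) with (b <ᵇ c) ∧ (d <ᵇ c)
  ... | true = inj₂ refl
  ... | false = inj₁ refl

  adjacent-peaks : ∀ b c d σ → isPeak b c (d ∷ σ) ≡ 1 → isPeak c d σ ≡ 1 → ⊥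
  adjacent-peaks b c d [] _ ()
  adjacent-peaks b c d (e ∷ σ) b<c>d c<d>e with b <ᵇ c | d <ᵇ c in d<c | c <ᵇ d in c<d
  adjacent-peaks b c d (e ∷ σ) () c<d>e | false | _ | _
  adjacent-peaks b c d (e ∷ σ) () c<d>e | true | false | _
  adjacent-peaks b c d (e ∷ σ) b<c>d () | true | true | false
  ... | true | true | true = ℕ.<-asym (<ᵇ⇒< d c (subst T (sym d<c) tt)) (<ᵇ⇒< c d (subst T (sym c<d) tt))

module RingSums (R : CommutativeRing 0ℓ 0ℓ) where

  open import Data.Nat as ℕ using (ℕ; zero; suc; _∸_; _<_; z≤n; s≤s)
  open import Data.Nat.Properties using (n<1+n)
  open import Data.Nat.Combinatorics using (_C_; nCk+nC[k+1]≡[n+1]C[k+1]; k>n⇒nCk≡0)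
  open import Data.List using (List; []; _∷_; map; foldr; _++_; concatMap)
  open import Data.List.Relation.Unary.All using (All; []; _∷_)
  open import Data.List.Relation.Binary.Permutation.Propositional using (_↭_; ↭⇒↭ₛ′)
  import Data.List.Relation.Binary.Permutation.Propositional.Properties as ↭
  import Data.List.Relation.Binary.Permutation.Setoid.Properties as ↭ₛ
  import Relation.Binary.PropositionalEquality as ≡

  open CommutativeRing R public
  open import Algebra.Properties.Semiring.Exp semiring public using (_^_; ^-congʳ)
  open import Algebra.Properties.CommutativeSemiring.Exp commutativeSemiring public using (^-distrib-*)
  open import Algebra.Properties.Semiring.Mult semiring using (_×_; ×-homo-+)
  open import Algebra.Solver.Ring.NaturalCoefficients.Default commutativeSemiring public
  open import Relation.Binary.Reasoning.Setoid setoid public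

  fromℕ : ℕ → Carrier
  fromℕ n = n × 1#

  fromℕ-homo-+ : ∀ m n → fromℕ (m ℕ.+ n) ≈ fromℕ m + fromℕ n
  fromℕ-homo-+ = ×-homo-+ 1#

  sum : List Carrier → Carrier
  sum = foldr _+_ 0#

  module _ {A : Set} where

    sum-++ : ∀ (f : A → Carrier) xs ys → sum (map f (xs ++ ys)) ≈ sum (map f xs) + sum (map f ys)
    sum-++ f [] ys = sym (+-identityˡ _)
    sum-++ f (x ∷ xs) ys = trans (+-congˡ (sum-++ f xs ys)) (sym (+-assoc _ _ _))

    sum-cong : ∀ {f g : A → Carrier} {xs} → All (λ x → f x ≈ g x) xs → sum (map f xs) ≈ sum (map g xs)
    sum-cong [] = refl
    sum-cong (e ∷ es) = +-cong e (sum-cong es)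

    sum-↭ : ∀ (f : A → Carrier) {xs ys} → xs ↭ ys → sum (map f xs) ≈ sum (map f ys)
    sum-↭ f p = ↭ₛ.foldr-commMonoid setoid +-isCommutativeMonoid (↭⇒↭ₛ′ isEquivalence (↭.map⁺ f p))

    sum-linear : ∀ c (f g : A → Carrier) xs → sum (map (λ z → c * f z + g z) xs) ≈ c * sum (map f xs) + sum (map g xs)
    sum-linear c f g [] = sym (trans (+-identityʳ _) (zeroʳ c))
    sum-linear c f g (x ∷ xs) = trans (+-congˡ (sum-linear c f g xs)) (shuffle _ _ _ _ _)
      where
      shuffle : ∀ c a b s t → (c * a + b) + (c * s + t) ≈ c * (a + s) + (b + t)
      shuffle = solve 5 (λ c a b s t → (c :* a :+ b) :+ (c :* s :+ t) := c :* (a :+ s) :+ (b :+ t)) refl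

  module _ {A B : Set} where

    sum-concatMap : ∀ (f : B → Carrier) (g : A → List B) xs →
      sum (map f (concatMap g xs)) ≈ sum (map (λ x → sum (map f (g x))) xs)
    sum-concatMap f g [] = refl
    sum-concatMap f g (x ∷ xs) = trans (sum-++ f (g x) (concatMap g xs)) (+-congˡ (sum-concatMap f g xs))

    sum-map : ∀ (f : B → Carrier) (g : A → B) xs → sum (map f (map g xs)) ≈ sum (map (λ x → f (g x)) xs)
    sum-map f g [] = refl
    sum-map f g (x ∷ xs) = +-congˡ (sum-map f g xs)

  ∑< : ℕ → (ℕ → Carrier) → Carrier
  ∑< zero f = 0#
  ∑< (suc n) f = f 0 + ∑< n (λ k → f (suc k))

  ∑<-cong : ∀ n {f g} → (∀ j → j < n → f j ≈ g j) → ∑< n f ≈ ∑< n g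
  ∑<-cong zero e = refl
  ∑<-cong (suc n) e = +-cong (e 0 (s≤s z≤n)) (∑<-cong n (λ j j<n → e (suc j) (s≤s j<n)))

  ∑<-snoc : ∀ n f → ∑< (suc n) f ≈ ∑< n f + f n
  ∑<-snoc zero f = trans (+-identityʳ _) (sym (+-identityˡ _))
  ∑<-snoc (suc n) f = trans (+-congˡ (∑<-snoc n (λ k → f (suc k)))) (sym (+-assoc _ _ _))

  ∑<-distrib-+ : ∀ n f g → ∑< n (λ k → f k + g k) ≈ ∑< n f + ∑< n g
  ∑<-distrib-+ zero f g = sym (+-identityʳ _)
  ∑<-distrib-+ (suc n) f g = trans (+-congˡ (∑<-distrib-+ n (λ k → f (suc k)) (λ k → g (suc k)))) (shuffle _ _ _ _)
    where
    shuffle : ∀ a b c d → (a + b) + (c + d) ≈ (a + c) + (b + d)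
    shuffle = solve 4 (λ a b c d → (a :+ b) :+ (c :+ d) := (a :+ c) :+ (b :+ d)) refl

  ∑<-distribˡ : ∀ n c f → c * ∑< n f ≈ ∑< n (λ k → c * f k)
  ∑<-distribˡ zero c f = zeroʳ c
  ∑<-distribˡ (suc n) c f = trans (distribˡ c _ _) (+-congˡ (∑<-distribˡ n c (λ k → f (suc k))))

  binomialTerm : Carrier → ℕ → (ℕ → Carrier) → ℕ → Carrier
  binomialTerm s n b k = fromℕ (n C k) * s ^ (n ∸ k) * b k

  binomialTransform : Carrier → ℕ → (ℕ → Carrier) → Carrier
  binomialTransform s n b = ∑< (suc n) (binomialTerm s n b)

  private
    ∸-suc : ∀ {j n} → j < n → n ∸ j ≡.≡ suc (n ∸ suc j)
    ∸-suc {zero} {suc n} _ = ≡.refl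
    ∸-suc {suc j} {suc n} (s≤s j<n) = ∸-suc j<n

  binomialTransform-linear : ∀ s n {b b′ d : ℕ → Carrier} c → (∀ k → b′ k ≈ c * b k + d k) →
    binomialTransform s n b′ ≈ c * binomialTransform s n b + binomialTransform s n d
  binomialTransform-linear s n {b} {b′} {d} c b′≈ = begin
    ∑< (suc n) (binomialTerm s n b′)
      ≈⟨ ∑<-cong (suc n) (λ k _ → trans (*-congˡ (b′≈ k)) (distribute (fromℕ (n C k) * s ^ (n ∸ k)) c (b k) (d k))) ⟩
    ∑< (suc n) (λ k → c * binomialTerm s n b k + binomialTerm s n d k)
      ≈⟨ ∑<-distrib-+ (suc n) (λ k → c * binomialTerm s n b k) (binomialTerm s n d) ⟩
    ∑< (suc n) (λ k → c * binomialTerm s n b k) + binomialTransform s n d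
      ≈⟨ +-congʳ (∑<-distribˡ (suc n) c (binomialTerm s n b)) ⟨
    c * binomialTransform s n b + binomialTransform s n d ∎
    where
    distribute : ∀ p c b d → p * (c * b + d) ≈ c * (p * b) + p * d
    distribute = solve 4 (λ p c b d → p :* (c :* b :+ d) := c :* (p :* b) :+ p :* d) refl

  binomialTransform-suc-pascal : ∀ s n b → binomialTransform s (suc n) b ≈
    binomialTerm s (suc n) b 0 + (binomialTransform s n (λ k → b (suc k)) + ∑< n (λ j → binomialTerm s n b (suc j) * s))
  binomialTransform-suc-pascal s n b = +-congˡ (begin
    ∑< (suc n) (λ j → binomialTerm s (suc n) b (suc j))
      ≈⟨ ∑<-cong (suc n) (λ j _ → pascal j) ⟩
    ∑< (suc n) (λ j → binomialTerm s n b′ j + shifted j)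
      ≈⟨ ∑<-distrib-+ (suc n) (binomialTerm s n b′) shifted ⟩
    binomialTransform s n b′ + ∑< (suc n) shifted
      ≈⟨ +-congˡ (∑<-snoc n shifted) ⟩
    binomialTransform s n b′ + (∑< n shifted + shifted n)
      ≈⟨ +-congˡ (trans (+-congˡ last-vanishes) (+-identityʳ _)) ⟩
    binomialTransform s n b′ + ∑< n shifted
      ≈⟨ +-congˡ (∑<-cong n (λ j j<n → shift-exponent j j<n)) ⟩
    binomialTransform s n b′ + ∑< n (λ j → binomialTerm s n b (suc j) * s) ∎)
    where
    b′ = λ k → b (suc k)
    shifted = λ j → fromℕ (n C suc j) * s ^ (n ∸ j) * b (suc j)
    pascal : ∀ j → binomialTerm s (suc n) b (suc j) ≈ binomialTerm s n b′ j + shifted j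
    pascal j = trans (*-congʳ (*-congʳ (trans (reflexive (≡.cong fromℕ (≡.sym (nCk+nC[k+1]≡[n+1]C[k+1] n j))))
                                              (fromℕ-homo-+ (n C j) (n C suc j)))))
                     (distribute _ _ _ _)
      where
      distribute : ∀ a b c d → (a + b) * c * d ≈ a * c * d + b * c * d
      distribute = solve 4 (λ a b c d → (a :+ b) :* c :* d := a :* c :* d :+ b :* c :* d) refl
    last-vanishes : shifted n ≈ 0#
    last-vanishes = trans (*-congʳ (*-congʳ (reflexive (≡.cong fromℕ (k>n⇒nCk≡0 (n<1+n n))))))
                          (trans (*-congʳ (zeroˡ _)) (zeroˡ _))
    shift-exponent : ∀ j → j < n → shifted j ≈ binomialTerm s n b (suc j) * s
    shift-exponent j j<n = trans (*-congʳ (*-congˡ (^-congʳ s (∸-suc j<n)))) (rotate _ _ _ _)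
      where
      rotate : ∀ c s p d → c * (s * p) * d ≈ c * p * d * s
      rotate = solve 4 (λ c s p d → c :* (s :* p) :* d := c :* p :* d :* s) refl

  *-binomialTransform : ∀ s n b → s * binomialTransform s n b ≈
    binomialTerm s (suc n) b 0 + ∑< n (λ j → binomialTerm s n b (suc j) * s)
  *-binomialTransform s n b =
    trans (∑<-distribˡ (suc n) s (binomialTerm s n b))
          (+-cong (lift _ _ _) (∑<-cong n (λ _ _ → *-comm _ _)))
    where
    lift : ∀ c p d → s * (c * p * d) ≈ c * (s * p) * d
    lift = solve 4 (λ s c p d → s :* (c :* p :* d) := c :* (s :* p) :* d) refl s

  binomialTransform-suc : ∀ s n b →
    binomialTransform s (suc n) b ≈ s * binomialTransform s n b + binomialTransform s n (λ k → b (suc k))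
  binomialTransform-suc s n b = begin
    binomialTransform s (suc n) b                       ≈⟨ binomialTransform-suc-pascal s n b ⟩
    t₀ + (binomialTransform s n (λ k → b (suc k)) + rest) ≈⟨ swap t₀ _ rest ⟩
    (t₀ + rest) + binomialTransform s n (λ k → b (suc k)) ≈⟨ +-congʳ (*-binomialTransform s n b) ⟨
    s * binomialTransform s n b + binomialTransform s n (λ k → b (suc k)) ∎
    where
    t₀ = binomialTerm s (suc n) b 0
    rest = ∑< n (λ j → binomialTerm s n b (suc j) * s)
    swap : ∀ a b c → a + (b + c) ≈ (a + c) + b
    swap = solve 3 (λ a b c → a :+ (b :+ c) := (a :+ c) :+ b) refl

module DualNumbers (R : CommutativeRing 0ℓ 0ℓ) where

  open import Data.Nat as ℕ using (ℕ; zero; suc; _∸_)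
  open import Data.Nat.Combinatorics using (_C_)
  open import Data.List using (List; []; _∷_; map)
  open import Data.Product using (_×_; _,_; proj₁; proj₂)
  open import Algebra.Structures using (IsCommutativeRing)
  open import Function using (_∘_)
  open RingSums R

  Dual : Set
  Dual = Carrier × Carrier

  infix 4 _≈ᵈ_
  infixl 6 _+ᵈ_
  infixl 7 _*ᵈ_

  _≈ᵈ_ : Dual → Dual → Set
  (a , a′) ≈ᵈ (b , b′) = a ≈ b × a′ ≈ b′

  _+ᵈ_ _*ᵈ_ : Dual → Dual → Dual
  (a , a′) +ᵈ (b , b′) = a + b , a′ + b′
  (a , a′) *ᵈ (b , b′) = a * b , a * b′ + a′ * b

  -ᵈ_ : Dual → Dual
  -ᵈ (a , a′) = - a , - a′

  0ᵈ 1ᵈ : Dual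
  0ᵈ = 0# , 0#
  1ᵈ = 1# , 0#

  *ᵈ-cong : ∀ {x y u v} → x ≈ᵈ y → u ≈ᵈ v → x *ᵈ u ≈ᵈ y *ᵈ v
  *ᵈ-cong (p , p′) (q , q′) = *-cong p q , +-cong (*-cong p q′) (*-cong p′ q)

  private
    *-assoc-ε : ∀ a a′ b b′ c c′ → (a * b) * c′ + (a * b′ + a′ * b) * c ≈ a * (b * c′ + b′ * c) + a′ * (b * c)
    *-assoc-ε = solve 6 (λ a a′ b b′ c c′ →
      (a :* b) :* c′ :+ (a :* b′ :+ a′ :* b) :* c := a :* (b :* c′ :+ b′ :* c) :+ a′ :* (b :* c)) refl
    *-identityˡ-ε : ∀ a a′ → 1# * a′ + 0# * a ≈ a′
    *-identityˡ-ε = solve 2 (λ a a′ → con 1 :* a′ :+ con 0 :* a := a′) refl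
    *-identityʳ-ε : ∀ a a′ → a * 0# + a′ * 1# ≈ a′
    *-identityʳ-ε = solve 2 (λ a a′ → a :* con 0 :+ a′ :* con 1 := a′) refl
    distribˡ-ε : ∀ a a′ b b′ c c′ → a * (b′ + c′) + a′ * (b + c) ≈ (a * b′ + a′ * b) + (a * c′ + a′ * c)
    distribˡ-ε = solve 6 (λ a a′ b b′ c c′ →
      a :* (b′ :+ c′) :+ a′ :* (b :+ c) := (a :* b′ :+ a′ :* b) :+ (a :* c′ :+ a′ :* c)) refl
    distribʳ-ε : ∀ a a′ b b′ c c′ → (b + c) * a′ + (b′ + c′) * a ≈ (b * a′ + b′ * a) + (c * a′ + c′ * a)
    distribʳ-ε = solve 6 (λ a a′ b b′ c c′ →
      (b :+ c) :* a′ :+ (b′ :+ c′) :* a := (b :* a′ :+ b′ :* a) :+ (c :* a′ :+ c′ :* a)) refl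
    *-comm-ε : ∀ a a′ b b′ → a * b′ + a′ * b ≈ b * a′ + b′ * a
    *-comm-ε = solve 4 (λ a a′ b b′ → a :* b′ :+ a′ :* b := b :* a′ :+ b′ :* a) refl

  dual-isCommutativeRing : IsCommutativeRing _≈ᵈ_ _+ᵈ_ _*ᵈ_ -ᵈ_ 0ᵈ 1ᵈ
  dual-isCommutativeRing = record
    { isRing = record
      { +-isAbelianGroup = record
        { isGroup = record
          { isMonoid = record
            { isSemigroup = record
              { isMagma = record
                { isEquivalence = record
                  { refl = refl , refl
                  ; sym = λ (p , p′) → sym p , sym p′
                  ; trans = λ (p , p′) (q , q′) → trans p q , trans p′ q′ }
                ; ∙-cong = λ (p , p′) (q , q′) → +-cong p q , +-cong p′ q′ }
              ; assoc = λ (a , _) (b , _) (c , _) → +-assoc a b c , +-assoc _ _ _ }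
            ; identity = (λ (a , a′) → +-identityˡ a , +-identityˡ a′)
                       , (λ (a , a′) → +-identityʳ a , +-identityʳ a′) }
          ; inverse = (λ (a , a′) → -‿inverseˡ a , -‿inverseˡ a′)
                    , (λ (a , a′) → -‿inverseʳ a , -‿inverseʳ a′)
          ; ⁻¹-cong = λ (p , p′) → -‿cong p , -‿cong p′ }
        ; comm = λ (a , a′) (b , b′) → +-comm a b , +-comm a′ b′ }
      ; *-cong = *ᵈ-cong
      ; *-assoc = λ (a , a′) (b , b′) (c , c′) → *-assoc a b c , *-assoc-ε a a′ b b′ c c′
      ; *-identity = (λ (a , a′) → *-identityˡ a , *-identityˡ-ε a a′)
                   , (λ (a , a′) → *-identityʳ a , *-identityʳ-ε a a′)
      ; distrib = (λ (a , a′) (b , b′) (c , c′) → distribˡ a b c , distribˡ-ε a a′ b b′ c c′)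
                , (λ (a , a′) (b , b′) (c , c′) → distribʳ a b c , distribʳ-ε a a′ b b′ c c′) }
    ; *-comm = λ (a , a′) (b , b′) → *-comm a b , *-comm-ε a a′ b b′ }

  dualRing : CommutativeRing 0ℓ 0ℓ
  dualRing = record { isCommutativeRing = dual-isCommutativeRing }

  module ᵈ = RingSums dualRing

  ^-tangent : Carrier → Carrier → ℕ → Carrier
  ^-tangent a a′ zero = 0#
  ^-tangent a a′ (suc n) = fromℕ (suc n) * a ^ n * a′

  ^-tangent-0 : ∀ a {a′} n → a′ ≈ 0# → ^-tangent a a′ n ≈ 0#
  ^-tangent-0 a zero _ = refl
  ^-tangent-0 a (suc n) a′≈0 = trans (*-congˡ a′≈0) (zeroʳ _)

  ^ᵈ : ∀ a a′ n → (a , a′) ᵈ.^ n ≈ᵈ (a ^ n , ^-tangent a a′ n)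
  ^ᵈ a a′ zero = refl , refl
  ^ᵈ a a′ (suc n) with p , p′ ← ^ᵈ a a′ n = *-congˡ p , trans (+-cong (*-congˡ p′) (*-congˡ p)) (leibniz n)
    where
    leibniz : ∀ n → a * ^-tangent a a′ n + a′ * a ^ n ≈ ^-tangent a a′ (suc n)
    leibniz zero = solve 2 (λ a a′ → a :* con 0 :+ a′ :* con 1 := (con 1 :+ con 0) :* con 1 :* a′) refl a a′
    leibniz (suc m) = solve 4 (λ a p a′ c → a :* (c :* p :* a′) :+ a′ :* (a :* p) := (con 1 :+ c) :* (a :* p) :* a′)
                            refl a (a ^ m) a′ (fromℕ (suc m))

  fromℕᵈ : ∀ n → ᵈ.fromℕ n ≈ᵈ (fromℕ n , 0#)
  fromℕᵈ zero = refl , refl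
  fromℕᵈ (suc n) with p , p′ ← fromℕᵈ n = +-congˡ p , trans (+-congˡ p′) (+-identityʳ 0#)

  sumᵈ : ∀ {A : Set} (f : A → Dual) xs → ᵈ.sum (map f xs) ≈ᵈ (sum (map (proj₁ ∘ f) xs) , sum (map (proj₂ ∘ f) xs))
  sumᵈ f [] = refl , refl
  sumᵈ f (z ∷ xs) with p , p′ ← sumᵈ f xs = +-congˡ p , +-congˡ p′

  ∑<ᵈ : ∀ n (f : ℕ → Dual) → proj₂ (ᵈ.∑< n f) ≈ ∑< n (proj₂ ∘ f)
  ∑<ᵈ zero f = refl
  ∑<ᵈ (suc n) f = +-congˡ (∑<ᵈ n (λ k → f (suc k)))

  binomialTransform-tangent : ∀ s {s′} → s′ ≈ 0# → ∀ n (b : ℕ → Dual) →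
    proj₂ (ᵈ.binomialTransform (s , s′) n b) ≈ binomialTransform s n (proj₂ ∘ b)
  binomialTransform-tangent s {s′} s′≈0 n b =
    trans (∑<ᵈ (suc n) (ᵈ.binomialTerm (s , s′) n b)) (∑<-cong (suc n) (λ k _ → tangent k))
    where
    tangent : ∀ k → proj₂ (ᵈ.binomialTerm (s , s′) n b k) ≈ binomialTerm s n (proj₂ ∘ b) k
    tangent k with _ , ∂ ← *ᵈ-cong (*ᵈ-cong (fromℕᵈ (n C k)) (^ᵈ s s′ (n ∸ k))) (refl {proj₁ (b k)} , refl {proj₂ (b k)}) =
      trans ∂ (trans (+-congˡ (*-congʳ (+-congʳ (*-congˡ (^-tangent-0 s (n ∸ k) s′≈0)))))
                     (solve 4 (λ c p b₁ b₂ → c :* p :* b₂ :+ (c :* con 0 :+ con 0 :* p) :* b₁ := c :* p :* b₂) refl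
                            (fromℕ (n C k)) (s ^ (n ∸ k)) (proj₁ (b k)) (proj₂ (b k))))

module Sides (R : CommutativeRing 0ℓ 0ℓ) where

  open import Defs using (peaks; des; asc; LRmin; RLmin; 𝔖)
  open import Data.Nat as ℕ using (ℕ; zero; suc; _∸_)
  open import Data.Nat.Combinatorics using (_C_)
  open import Data.List using (List; map; applyUpTo)
  open RingSums R

  peakTerm : Carrier → ℕ → Carrier → Carrier → Carrier → Carrier → List ℕ → Carrier
  peakTerm half n x y α β σ = (x * y) ^ peaks σ * ((x + y) * half) ^ (n ∸ 2 ℕ.* peaks σ)
                            * α ^ (LRmin σ ∸ 1) * β ^ (RLmin σ ∸ 1)

  lhs : Carrier → ℕ → Carrier → Carrier → Carrier → Carrier → Carrier
  lhs half n x y α β = sum (map (peakTerm half n x y α β) (𝔖 (suc n)))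

  desAscTerm : Carrier → Carrier → Carrier → List ℕ → Carrier
  desAscTerm x y t σ = x ^ suc (des σ) * y ^ asc σ * t ^ LRmin σ

  desAscSum : ℕ → Carrier → Carrier → Carrier → Carrier
  desAscSum k x y t = sum (map (desAscTerm x y t) (𝔖 k))

  rhs : Carrier → ℕ → Carrier → Carrier → Carrier → Carrier → Carrier
  rhs half n x y α β =
    sum (map (λ k → fromℕ (n C k) * ((α + β) * (y - x)) ^ (n ∸ k) * half ^ (n ∸ k) * desAscSum k x y (α + β))
             (applyUpTo suc n))
    + ((α + β) * (y - x) * half) ^ n

  -- The k = 0 term of the right-hand side is s ^ n, so the sequence starts with 1, not with desAscSum 0 = x.
  desAscSeq : Carrier → Carrier → Carrier → ℕ → Carrier
  desAscSeq x y t zero = 1#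
  desAscSeq x y t (suc k) = desAscSum (suc k) x y t

  private
    sum-applyUpTo : ∀ (f : ℕ → Carrier) g n → sum (map f (applyUpTo g n)) ≈ ∑< n (λ k → f (g k))
    sum-applyUpTo f g zero = refl
    sum-applyUpTo f g (suc n) = +-congˡ (sum-applyUpTo f (λ k → g (suc k)) n)

  rhs≈binomialTransform : ∀ half n x y α β →
    rhs half n x y α β ≈ binomialTransform ((α + β) * (y - x) * half) n (desAscSeq x y (α + β))
  rhs≈binomialTransform half n x y α β = begin
    rhs half n x y α β
      ≈⟨ +-congʳ (trans (sum-applyUpTo _ suc n) (∑<-cong n (λ j _ → *-congʳ (split-power j)))) ⟩
    ∑< n (λ j → binomialTerm s n b (suc j)) + s ^ n
      ≈⟨ +-comm _ _ ⟩
    s ^ n + ∑< n (λ j → binomialTerm s n b (suc j))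
      ≈⟨ +-congʳ (solve 1 (λ p → p := (con 1 :+ con 0) :* p :* con 1) refl (s ^ n)) ⟩
    binomialTransform s n b ∎
    where
    s = (α + β) * (y - x) * half
    b = desAscSeq x y (α + β)
    split-power : ∀ j → fromℕ (n C suc j) * ((α + β) * (y - x)) ^ (n ∸ suc j) * half ^ (n ∸ suc j)
                      ≈ fromℕ (n C suc j) * s ^ (n ∸ suc j)
    split-power j = trans (*-assoc _ _ _) (*-congˡ (sym (^-distrib-* _ half (n ∸ suc j))))

module InteriorInsertionSums (R : CommutativeRing 0ℓ 0ℓ) where

  open import Defs using (peaks; des; asc)
  open import Data.Nat as ℕ using (ℕ; suc; _<_; _<ᵇ_)
  open import Data.Nat.Properties as ℕ using (<⇒≤)
  open import Data.Bool.Properties using (∧-zeroʳ)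
  open import Data.List using (List; []; _∷_; map; length)
  open import Data.List.Relation.Unary.All as All using (All; []; _∷_)
  open import Data.List.Relation.Unary.AllPairs using (_∷_)
  open import Data.List.Relation.Unary.Unique.Propositional using (Unique)
  open import Data.Product using (∃; ∃₂; _×_; _,_)
  open import Data.Sum using (_⊎_; inj₁; inj₂)
  open import Data.Empty using (⊥; ⊥-elim)
  open import Relation.Binary.Definitions using (tri<; tri≈; tri>)
  import Relation.Binary.PropositionalEquality as ≡
  open RingSums R
  open InsertionStatistics

  twoPoint : ℕ → ℕ → ℕ → (ℕ → Carrier) → Carrier
  twoPoint A B P f = fromℕ A * f (suc P) + fromℕ B * f P

  twoPoint-sucˡ : ∀ A B P f → f (suc P) + twoPoint A B P f ≈ twoPoint (suc A) B P f
  twoPoint-sucˡ A B P f = solve 4 (λ v w k l → v :+ (k :* v :+ l :* w) := (con 1 :+ k) :* v :+ l :* w) refl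
                            (f (suc P)) (f P) (fromℕ A) (fromℕ B)

  twoPoint-sucʳ : ∀ A B P f → f P + twoPoint A B P f ≈ twoPoint A (suc B) P f
  twoPoint-sucʳ A B P f = solve 4 (λ v w k l → w :+ (k :* v :+ l :* w) := k :* v :+ (con 1 :+ l) :* w) refl
                            (f (suc P)) (f P) (fromℕ A) (fromℕ B)

  twoPoint-0 : ∀ P f → 0# ≈ twoPoint 0 0 P f
  twoPoint-0 P f = solve 2 (λ v w → con 0 := con 0 :* v :+ con 0 :* w) refl (f (suc P)) (f P)

  private
    2*-suc : ∀ n → 2 ℕ.* suc n ≡.≡ suc (suc (2 ℕ.* n))
    2*-suc n = ≡.cong suc (ℕ.+-suc n (n ℕ.+ 0))

    -- The insertion into the first gap of c ∷ d ∷ σ has 1 + peaks (d ∷ σ) peaks: one more than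
    -- b ∷ c ∷ d ∷ σ unless c or d is a peak there (q = 1 or q′ = 1), and not both can be.
    absorb-peak : ∀ {q q′ pd P′ A′ B′ L} (G : (ℕ → Carrier) → Carrier) →
      q ≡.≡ 0 ⊎ q ≡.≡ 1 → q′ ≡.≡ 0 ⊎ q′ ≡.≡ 1 → (q ≡.≡ 1 → q′ ≡.≡ 1 → ⊥) →
      P′ ≡.≡ q′ ℕ.+ pd → A′ ℕ.+ B′ ≡.≡ L → B′ ℕ.+ q′ ≡.≡ 2 ℕ.* P′ →
      (∀ f → G f ≈ f (suc pd) + twoPoint A′ B′ P′ (λ k → f (q ℕ.+ k))) →
      ∃₂ λ A B → A ℕ.+ B ≡.≡ suc L × B ℕ.+ q ≡.≡ 2 ℕ.* (q ℕ.+ P′) × ∀ f → G f ≈ twoPoint A B (q ℕ.+ P′) f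
    absorb-peak {A′ = A′} {B′} G (inj₁ ≡.refl) (inj₁ ≡.refl) _ ≡.refl ≡.refl eB hG =
      suc A′ , B′ , ≡.refl , eB , λ f → trans (hG f) (twoPoint-sucˡ A′ B′ _ f)
    absorb-peak {pd = pd} {A′ = A′} {B′} G (inj₂ ≡.refl) (inj₁ ≡.refl) _ ≡.refl ≡.refl eB hG =
      A′ , suc B′ , ℕ.+-suc A′ B′ ,
      ≡.trans (ℕ.+-comm (suc B′) 1) (≡.trans (≡.cong (λ z → suc (suc z)) (≡.trans (≡.sym (ℕ.+-identityʳ B′)) eB)) (≡.sym (2*-suc pd))) ,
      λ f → trans (hG f) (twoPoint-sucʳ A′ B′ _ f)
    absorb-peak {A′ = A′} {B′} G (inj₁ ≡.refl) (inj₂ ≡.refl) _ ≡.refl ≡.refl eB hG =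
      A′ , suc B′ , ℕ.+-suc A′ B′ , ≡.trans (ℕ.+-identityʳ (suc B′)) (≡.trans (ℕ.+-comm 1 B′) eB) ,
      λ f → trans (hG f) (twoPoint-sucʳ A′ B′ _ f)
    absorb-peak G (inj₂ ≡.refl) (inj₂ ≡.refl) both = ⊥-elim (both ≡.refl ≡.refl)

  interiorInsertions-peaks-after : ∀ a b c σ → All (_< a) (c ∷ σ) →
    ∃₂ λ A B → A ℕ.+ B ≡.≡ length σ × B ℕ.+ isPeak b c σ ≡.≡ 2 ℕ.* peaks (b ∷ c ∷ σ) ×
      ∀ f → sum (map (λ τ → f (peaks (b ∷ τ))) (interiorInsertions a (c ∷ σ))) ≈ twoPoint A B (peaks (b ∷ c ∷ σ)) f
  interiorInsertions-peaks-after a b c [] _ = 0 , 0 , ≡.refl , ≡.refl , λ f → twoPoint-0 _ f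
  interiorInsertions-peaks-after a b c (d ∷ σ) (c<a ∷ p@(d<a ∷ _))
    with A′ , B′ , eL , eB , hT ← interiorInsertions-peaks-after a c d σ p =
    absorb-peak (λ f → sum (map (λ τ → f (peaks (b ∷ τ))) (interiorInsertions a (c ∷ d ∷ σ))))
      (isPeak-0∨1 b c (d ∷ σ)) (isPeak-0∨1 c d σ) (adjacent-peaks b c d σ) (peaks-∷-∷ c d σ) eL eB split
    where
    new-peak : peaks (b ∷ c ∷ a ∷ d ∷ σ) ≡.≡ suc (peaks (d ∷ σ))
    new-peak rewrite <ᵇ-false {a} {c} (<⇒≤ c<a) | ∧-zeroʳ (b <ᵇ c) | <ᵇ-true c<a | <ᵇ-true d<a =
      ≡.cong suc (peaks-∷-max a (d ∷ σ) p)
    split : ∀ f → sum (map (λ τ → f (peaks (b ∷ τ))) (interiorInsertions a (c ∷ d ∷ σ))) ≈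
                  f (suc (peaks (d ∷ σ))) + twoPoint A′ B′ (peaks (c ∷ d ∷ σ)) (λ k → f (isPeak b c (d ∷ σ) ℕ.+ k))
    split f = +-cong (reflexive (≡.cong f new-peak))
      (trans (sum-map (λ τ → f (peaks (b ∷ τ))) (c ∷_) (interiorInsertions a (d ∷ σ)))
        (trans (sum-cong (All.map (λ { (r , ≡.refl) → refl }) (interiorInsertions-∷ a d σ)))
          (hT (λ k → f (isPeak b c (d ∷ σ) ℕ.+ k)))))

  interiorInsertions-peaks : ∀ a b σ → All (_< a) (b ∷ σ) →
    ∃ λ A → A ℕ.+ 2 ℕ.* peaks (b ∷ σ) ≡.≡ length σ ×
      ∀ f → sum (map (λ τ → f (peaks τ)) (interiorInsertions a (b ∷ σ))) ≈ twoPoint A (2 ℕ.* peaks (b ∷ σ)) (peaks (b ∷ σ)) f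
  interiorInsertions-peaks a b [] _ = 0 , ≡.refl , λ f → twoPoint-0 _ f
  interiorInsertions-peaks a b (c ∷ σ) (b<a ∷ p@(c<a ∷ _))
    with A′ , B′ , eL , eB , hT ← interiorInsertions-peaks-after a b c σ p
    with rest ← (λ f → trans (sum-map (λ τ → f (peaks τ)) (b ∷_) (interiorInsertions a (c ∷ σ))) (hT f))
    with isPeak b c σ | isPeak-0∨1 b c σ | peaks-∷-∷ b c σ
  ... | _ | inj₁ ≡.refl | eP rewrite ≡.trans (≡.sym (ℕ.+-identityʳ B′)) eB =
    suc A′ , ≡.cong suc eL , λ f → trans (+-cong (reflexive (≡.cong f (≡.trans new-peak (≡.cong suc (≡.sym eP))))) (rest f))
                                          (twoPoint-sucˡ A′ (2 ℕ.* peaks (b ∷ c ∷ σ)) _ f)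
    where
    new-peak : peaks (b ∷ a ∷ c ∷ σ) ≡.≡ suc (peaks (c ∷ σ))
    new-peak rewrite <ᵇ-true b<a | <ᵇ-true c<a = ≡.cong suc (peaks-∷-max a (c ∷ σ) p)
  ... | _ | inj₂ ≡.refl | eP rewrite ≡.sym eB =
    A′ , ≡.trans (≡.cong (A′ ℕ.+_) (ℕ.+-comm B′ 1)) (≡.trans (ℕ.+-suc A′ B′) (≡.cong suc eL)) ,
    λ f → trans (+-cong (reflexive (≡.cong f (≡.trans new-peak (≡.sym eP)))) (rest f))
                (trans (twoPoint-sucʳ A′ B′ _ f) (+-congˡ (*-congʳ (reflexive (≡.cong fromℕ (ℕ.+-comm 1 B′))))))
    where
    new-peak : peaks (b ∷ a ∷ c ∷ σ) ≡.≡ suc (peaks (c ∷ σ))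
    new-peak rewrite <ᵇ-true b<a | <ᵇ-true c<a = ≡.cong suc (peaks-∷-max a (c ∷ σ) p)

  private
    new-gap : ∀ {a} b c σ (f : ℕ → ℕ → Carrier) → b < a → c < a →
              f (des (b ∷ a ∷ c ∷ σ)) (asc (b ∷ a ∷ c ∷ σ)) ≈ f (suc (des (c ∷ σ))) (suc (asc (c ∷ σ)))
    new-gap {a} b c σ f b<a c<a
      rewrite <ᵇ-false {a} {b} (<⇒≤ b<a) | <ᵇ-true c<a | <ᵇ-true b<a | <ᵇ-false {a} {c} (<⇒≤ c<a) = refl

    des-asc-∷ : ∀ a b c σ (f g : ℕ → ℕ → Carrier) → (∀ r → f (des (b ∷ c ∷ r)) (asc (b ∷ c ∷ r)) ≈ g (des (c ∷ r)) (asc (c ∷ r))) →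
      sum (map (λ τ → f (des τ) (asc τ)) (map (b ∷_) (interiorInsertions a (c ∷ σ)))) ≈
      sum (map (λ τ → g (des τ) (asc τ)) (interiorInsertions a (c ∷ σ)))
    des-asc-∷ a b c σ f g e =
      trans (sum-map (λ τ → f (des τ) (asc τ)) (b ∷_) (interiorInsertions a (c ∷ σ)))
            (sum-cong (All.map (λ { (r , ≡.refl) → e r }) (interiorInsertions-∷ a c σ)))

  interiorInsertions-des-asc : ∀ a σ → Unique σ → All (_< a) σ → ∀ (f : ℕ → ℕ → Carrier) →
    sum (map (λ τ → f (des τ) (asc τ)) (interiorInsertions a σ)) ≈
      fromℕ (des σ) * f (des σ) (suc (asc σ)) + fromℕ (asc σ) * f (suc (des σ)) (asc σ)
  interiorInsertions-des-asc a [] _ _ f = solve 2 (λ v w → con 0 := con 0 :* v :+ con 0 :* w) refl _ _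
  interiorInsertions-des-asc a (b ∷ []) _ _ f = solve 2 (λ v w → con 0 := con 0 :* v :+ con 0 :* w) refl _ _
  interiorInsertions-des-asc a (b ∷ c ∷ σ) ((b≢c ∷ _) ∷ u) (b<a ∷ p@(c<a ∷ _)) f with ℕ.<-cmp b c
  ... | tri≈ _ b≡c _ = ⊥-elim (b≢c b≡c)
  ... | tri< b<c _ _ rewrite <ᵇ-true b<c | <ᵇ-false {c} {b} (<⇒≤ b<c) =
    trans (+-cong (new-gap b c σ f b<a c<a)
                  (trans (des-asc-∷ a b c σ f (λ d e → f d (suc e)) ascent)
                         (interiorInsertions-des-asc a (c ∷ σ) u p (λ d e → f d (suc e)))))
          (solve 4 (λ v w k l → w :+ (k :* v :+ l :* w) := k :* v :+ (con 1 :+ l) :* w) refl _ _ _ _)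
    where
    ascent : ∀ r → f (des (b ∷ c ∷ r)) (asc (b ∷ c ∷ r)) ≈ f (des (c ∷ r)) (suc (asc (c ∷ r)))
    ascent r rewrite <ᵇ-true b<c | <ᵇ-false {c} {b} (<⇒≤ b<c) = refl
  ... | tri> _ _ c<b rewrite <ᵇ-true c<b | <ᵇ-false {b} {c} (<⇒≤ c<b) =
    trans (+-cong (new-gap b c σ f b<a c<a)
                  (trans (des-asc-∷ a b c σ f (λ d e → f (suc d) e) descent)
                         (interiorInsertions-des-asc a (c ∷ σ) u p (λ d e → f (suc d) e))))
          (solve 4 (λ v w k l → v :+ (k :* v :+ l :* w) := (con 1 :+ k) :* v :+ l :* w) refl _ _ _ _)
    where
    descent : ∀ r → f (des (b ∷ c ∷ r)) (asc (b ∷ c ∷ r)) ≈ f (suc (des (c ∷ r))) (asc (c ∷ r))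
    descent r rewrite <ᵇ-true c<b | <ᵇ-false {b} {c} (<⇒≤ c<b) = refl

module InsertionRecurrences (R : CommutativeRing 0ℓ 0ℓ) where

  open import Defs using (peaks; des; asc; LRmin; RLmin; 𝔖)
  open import Data.Nat as ℕ using (ℕ; suc; _∸_; _<_)
  import Data.Nat.Properties as ℕ
  open import Data.List using (List; []; _∷_; map; length; _++_; concatMap)
  open import Data.List.Membership.Propositional using (_∈_)
  open import Data.List.Relation.Unary.All as All using (All; []; _∷_)
  open import Data.Product using (∃; _×_; _,_; proj₁; proj₂)
  open import Function using (_∘_)
  import Relation.Binary.PropositionalEquality as ≡
  open RingSums R
  open Sides R
  open InteriorInsertionSums R
  open InsertionStatistics
  open Permutations using (insertions; ∈-𝔖⁻; ∈-𝔖⇒<; 𝔖-suc↭)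

  private
    suc∸2*suc : ∀ n M → suc n ∸ 2 ℕ.* suc M ≡.≡ (n ∸ 2 ℕ.* M) ∸ 1
    suc∸2*suc n M = ≡.trans (≡.cong (suc n ∸_) (ℕ.*-suc 2 M))
                   (≡.trans (≡.cong (n ∸_) (ℕ.+-comm 1 (2 ℕ.* M))) (≡.sym (ℕ.∸-+-assoc n (2 ℕ.* M) 1)))

  module _ (half x y α β : Carrier) where

    private
      u = x * y
      h = (x + y) * half

    peakShape : ℕ → ℕ → ℕ → ℕ → Carrier
    peakShape n m l r = u ^ m * h ^ (n ∸ 2 ℕ.* m) * α ^ (l ∸ 1) * β ^ (r ∸ 1)

    -- D (peakShape n m l r), for the derivation with D u = 2 u h and D h = u.
    ∂peakShape : ℕ → ℕ → ℕ → ℕ → Carrier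
    ∂peakShape n m l r =
      (fromℕ (2 ℕ.* m) * h * (u ^ m * h ^ (n ∸ 2 ℕ.* m)) + fromℕ (n ∸ 2 ℕ.* m) * (u ^ suc m * h ^ ((n ∸ 2 ℕ.* m) ∸ 1)))
      * α ^ (l ∸ 1) * β ^ (r ∸ 1)

    ∂peakTerm : ℕ → List ℕ → Carrier
    ∂peakTerm n σ = ∂peakShape n (peaks σ) (LRmin σ) (RLmin σ)

    peakShape-cong : ∀ n {m m′ l l′ r r′} → m ≡.≡ m′ → l ≡.≡ l′ → r ≡.≡ r′ → peakShape n m l r ≈ peakShape n m′ l′ r′
    peakShape-cong n ≡.refl ≡.refl ≡.refl = refl

    peakTerm-∷-max : ∀ n {a} b σ → All (_< a) (b ∷ σ) →
      peakTerm half n x y α β (a ∷ b ∷ σ) ≈ α * peakShape n (peaks (b ∷ σ)) (LRmin (b ∷ σ)) (RLmin (b ∷ σ))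
    peakTerm-∷-max n {a} b σ p =
      trans (peakShape-cong n (peaks-∷-max a (b ∷ σ) p) (LRmin-∷-max b σ p) (RLmin-∷-max b σ p))
            (solve 4 (λ U α aL bR → U :* (α :* aL) :* bR := α :* (U :* aL :* bR)) refl _ α _ _)

    peakTerm-∷ʳ-max : ∀ n {a} b σ → All (_< a) (b ∷ σ) →
      peakTerm half n x y α β ((b ∷ σ) ++ a ∷ []) ≈ β * peakShape n (peaks (b ∷ σ)) (LRmin (b ∷ σ)) (RLmin (b ∷ σ))
    peakTerm-∷ʳ-max n {a} b σ p =
      trans (peakShape-cong n (peaks-∷ʳ-max a (b ∷ σ) p) (LRmin-∷ʳ-max b σ p)
                            (≡.trans (RLmin-∷ʳ-max b σ p) (≡.cong suc (RLmin-∷-nonzero b σ))))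
            (solve 4 (λ U aL β bR → U :* aL :* (β :* bR) := β :* (U :* aL :* bR)) refl _ _ β _)

    interiorInsertions-peakTerm : ∀ n {a} b σ → All (_< a) (b ∷ σ) →
      ∃ λ A → A ℕ.+ 2 ℕ.* peaks (b ∷ σ) ≡.≡ length σ ×
        sum (map (peakTerm half n x y α β) (interiorInsertions a (b ∷ σ))) ≈
          twoPoint A (2 ℕ.* peaks (b ∷ σ)) (peaks (b ∷ σ)) (λ m → peakShape n m (LRmin (b ∷ σ)) (RLmin (b ∷ σ)))
    interiorInsertions-peakTerm n {a} b σ p with A , eA , sum≈ ← interiorInsertions-peaks a b σ p =
      A , eA ,
      trans (sum-cong (All.map (λ {τ} (l , r) → peakShape-cong n {peaks τ} ≡.refl l r) (interiorInsertions-LRmin-RLmin a (b ∷ σ) p)))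
            (sum≈ (λ m → peakShape n m (LRmin (b ∷ σ)) (RLmin (b ∷ σ))))

    peakShape-insertions : ∀ n M A l r → A ℕ.+ 2 ℕ.* M ≡.≡ n →
      α * peakShape (suc n) M l r + (twoPoint A (2 ℕ.* M) M (λ m → peakShape (suc n) m l r) + (β * peakShape (suc n) M l r + 0#))
        ≈ (α + β) * h * peakShape n M l r + ∂peakShape n M l r
    peakShape-insertions n M A l r A+2M≡n = begin
      α * S M + ((fromℕ A * S (suc M) + fromℕ (2 ℕ.* M) * S M) + (β * S M + 0#))
        ≈⟨ +-cong (*-congˡ S-M) (+-cong (+-cong (*-cong (reflexive (≡.cong fromℕ A≡E)) S-sucM) (*-congˡ S-M))
                                        (+-congʳ (*-congˡ S-M))) ⟩
      α * (U * (h * H) * aL * bR) + ((fromℕ E * (U₁ * H₁ * aL * bR) + fromℕ (2 ℕ.* M) * (U * (h * H) * aL * bR))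
                                    + (β * (U * (h * H) * aL * bR) + 0#))
        ≈⟨ solve 11 (λ α β h U H U₁ H₁ aL bR cE c2 →
             α :* (U :* (h :* H) :* aL :* bR) :+ ((cE :* (U₁ :* H₁ :* aL :* bR) :+ c2 :* (U :* (h :* H) :* aL :* bR))
                                                   :+ (β :* (U :* (h :* H) :* aL :* bR) :+ con 0))
             := (α :+ β) :* h :* (U :* H :* aL :* bR) :+ (c2 :* h :* (U :* H) :+ cE :* (U₁ :* H₁)) :* aL :* bR)
             refl α β h U H U₁ H₁ aL bR (fromℕ E) (fromℕ (2 ℕ.* M)) ⟩
      (α + β) * h * peakShape n M l r + ∂peakShape n M l r ∎
      where
      E = n ∸ 2 ℕ.* M
      S = λ m → peakShape (suc n) m l r
      U = u ^ M
      U₁ = u ^ suc M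
      H = h ^ E
      H₁ = h ^ (E ∸ 1)
      aL = α ^ (l ∸ 1)
      bR = β ^ (r ∸ 1)
      A≡E : A ≡.≡ E
      A≡E = ≡.trans (≡.sym (ℕ.m+n∸n≡m A (2 ℕ.* M))) (≡.cong (_∸ 2 ℕ.* M) A+2M≡n)
      S-M : S M ≈ U * (h * H) * aL * bR
      S-M = *-congʳ (*-congʳ (*-congˡ (^-congʳ h
              (ℕ.+-∸-assoc 1 (≡.subst (2 ℕ.* M ℕ.≤_) A+2M≡n (ℕ.m≤n+m (2 ℕ.* M) A))))))
      S-sucM : S (suc M) ≈ U₁ * H₁ * aL * bR
      S-sucM = *-congʳ (*-congʳ (*-congˡ (^-congʳ h (suc∸2*suc n M))))

    insertions-peakTerm : ∀ n {σ} → σ ∈ 𝔖 (suc n) →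
      sum (map (peakTerm half (suc n) x y α β) (insertions (suc (suc n)) σ)) ≈
        (α + β) * h * peakTerm half n x y α β σ + ∂peakTerm n σ
    insertions-peakTerm n {[]} σ∈ with () ← proj₁ (proj₂ (∈-𝔖⁻ (suc n) σ∈))
    insertions-peakTerm n {b ∷ σ} σ∈
      with A , A+2M≡ , interior ← interiorInsertions-peakTerm (suc n) b σ (∈-𝔖⇒< (suc n) σ∈) = begin
      sum (map w (insertions a (b ∷ σ)))
        ≈⟨ reflexive (≡.cong (sum ∘ map w) (insertions-∷ a b σ)) ⟩
      w (a ∷ b ∷ σ) + sum (map w (interiorInsertions a (b ∷ σ) ++ ((b ∷ σ) ++ a ∷ []) ∷ []))
        ≈⟨ +-congˡ (sum-++ w (interiorInsertions a (b ∷ σ)) _) ⟩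
      w (a ∷ b ∷ σ) + (sum (map w (interiorInsertions a (b ∷ σ))) + (w ((b ∷ σ) ++ a ∷ []) + 0#))
        ≈⟨ +-cong (peakTerm-∷-max (suc n) b σ bounded)
                  (+-cong interior (+-congʳ (peakTerm-∷ʳ-max (suc n) b σ bounded))) ⟩
      α * S M + (twoPoint A (2 ℕ.* M) M S + (β * S M + 0#))
        ≈⟨ peakShape-insertions n M A (LRmin (b ∷ σ)) (RLmin (b ∷ σ))
             (≡.trans A+2M≡ (ℕ.suc-injective (proj₁ (proj₂ (∈-𝔖⁻ (suc n) σ∈))))) ⟩
      (α + β) * h * peakTerm half n x y α β (b ∷ σ) + ∂peakTerm n (b ∷ σ) ∎
      where
      a = suc (suc n)
      w = peakTerm half (suc n) x y α β
      bounded = ∈-𝔖⇒< (suc n) σ∈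
      M = peaks (b ∷ σ)
      S = λ m → peakShape (suc n) m (LRmin (b ∷ σ)) (RLmin (b ∷ σ))

  module _ (x y t : Carrier) where

    ∂desAscTerm : List ℕ → Carrier
    ∂desAscTerm σ = (fromℕ (suc (des σ)) * y + fromℕ (asc σ) * x) * desAscTerm x y t σ

    desAscShape : ℕ → ℕ → ℕ → Carrier
    desAscShape d e l = x ^ suc d * y ^ e * t ^ l

    desAscShape-cong : ∀ {d d′ e e′ l l′} → d ≡.≡ d′ → e ≡.≡ e′ → l ≡.≡ l′ → desAscShape d e l ≈ desAscShape d′ e′ l′
    desAscShape-cong ≡.refl ≡.refl ≡.refl = refl

    insertions-desAscTerm : ∀ k {σ} → σ ∈ 𝔖 (suc k) →
      sum (map (desAscTerm x y t) (insertions (suc (suc k)) σ)) ≈ t * x * desAscTerm x y t σ + ∂desAscTerm σ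
    insertions-desAscTerm k {[]} σ∈ with () ← proj₁ (proj₂ (∈-𝔖⁻ (suc k) σ∈))
    insertions-desAscTerm k {b ∷ σ} σ∈ = begin
      sum (map w (insertions a (b ∷ σ)))
        ≈⟨ reflexive (≡.cong (sum ∘ map w) (insertions-∷ a b σ)) ⟩
      w (a ∷ b ∷ σ) + sum (map w (interiorInsertions a (b ∷ σ) ++ ((b ∷ σ) ++ a ∷ []) ∷ []))
        ≈⟨ +-congˡ (sum-++ w (interiorInsertions a (b ∷ σ)) _) ⟩
      w (a ∷ b ∷ σ) + (sum (map w (interiorInsertions a (b ∷ σ))) + (w ((b ∷ σ) ++ a ∷ []) + 0#))
        ≈⟨ +-cong front (+-cong interior (+-congʳ end)) ⟩
      x * X * Y * (t * T) + ((fromℕ d * (X * (y * Y) * T) + fromℕ e * (x * X * Y * T)) + (X * (y * Y) * T + 0#))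
        ≈⟨ solve 8 (λ t x y X Y T cd ce →
             x :* X :* Y :* (t :* T) :+ ((cd :* (X :* (y :* Y) :* T) :+ ce :* (x :* X :* Y :* T)) :+ (X :* (y :* Y) :* T :+ con 0))
             := t :* x :* (X :* Y :* T) :+ ((con 1 :+ cd) :* y :+ ce :* x) :* (X :* Y :* T))
             refl t x y X Y T (fromℕ d) (fromℕ e) ⟩
      t * x * desAscTerm x y t (b ∷ σ) + ∂desAscTerm (b ∷ σ) ∎
      where
      a = suc (suc k)
      w = desAscTerm x y t
      bounded = ∈-𝔖⇒< (suc k) σ∈
      d = des (b ∷ σ)
      e = asc (b ∷ σ)
      X = x ^ suc d
      Y = y ^ e
      T = t ^ LRmin (b ∷ σ)
      front : w (a ∷ b ∷ σ) ≈ x * X * Y * (t * T)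
      front = desAscShape-cong (des-∷-max a b σ (All.head bounded)) (asc-∷-max a b σ (All.head bounded)) (LRmin-∷-max b σ bounded)
      end : w ((b ∷ σ) ++ a ∷ []) ≈ X * (y * Y) * T
      end = desAscShape-cong (des-∷ʳ-max a (b ∷ σ) bounded) (asc-∷ʳ-max a b σ bounded) (LRmin-∷ʳ-max b σ bounded)
      interior : sum (map w (interiorInsertions a (b ∷ σ))) ≈ fromℕ d * (X * (y * Y) * T) + fromℕ e * (x * X * Y * T)
      interior = trans (sum-cong (All.map (λ {τ} (l , _) → desAscShape-cong {des τ} {_} {asc τ} ≡.refl ≡.refl l)
                                         (interiorInsertions-LRmin-RLmin a (b ∷ σ) bounded)))
                       (interiorInsertions-des-asc a (b ∷ σ) (proj₁ (∈-𝔖⁻ (suc k) σ∈)) bounded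
                         (λ p q → desAscShape p q (LRmin (b ∷ σ))))

  lhs-suc : ∀ half n x y α β → lhs half (suc n) x y α β ≈
    (α + β) * ((x + y) * half) * lhs half n x y α β + sum (map (∂peakTerm half x y α β n) (𝔖 (suc n)))
  lhs-suc half n x y α β = begin
    sum (map w (𝔖 (suc (suc n))))
      ≈⟨ sum-↭ w (𝔖-suc↭ (suc n)) ⟩
    sum (map w (concatMap (insertions (suc (suc n))) (𝔖 (suc n))))
      ≈⟨ sum-concatMap w (insertions (suc (suc n))) (𝔖 (suc n)) ⟩
    sum (map (λ σ → sum (map w (insertions (suc (suc n)) σ))) (𝔖 (suc n)))
      ≈⟨ sum-cong (All.tabulate (insertions-peakTerm half x y α β n)) ⟩
    sum (map (λ σ → (α + β) * ((x + y) * half) * peakTerm half n x y α β σ + ∂peakTerm half x y α β n σ) (𝔖 (suc n)))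
      ≈⟨ sum-linear _ (peakTerm half n x y α β) (∂peakTerm half x y α β n) (𝔖 (suc n)) ⟩
    (α + β) * ((x + y) * half) * lhs half n x y α β + sum (map (∂peakTerm half x y α β n) (𝔖 (suc n))) ∎
    where w = peakTerm half (suc n) x y α β

  desAscSum-suc : ∀ k x y t →
    desAscSum (suc (suc k)) x y t ≈ t * x * desAscSum (suc k) x y t + sum (map (∂desAscTerm x y t) (𝔖 (suc k)))
  desAscSum-suc k x y t = begin
    sum (map w (𝔖 (suc (suc k))))
      ≈⟨ sum-↭ w (𝔖-suc↭ (suc k)) ⟩
    sum (map w (concatMap (insertions (suc (suc k))) (𝔖 (suc k))))
      ≈⟨ sum-concatMap w (insertions (suc (suc k))) (𝔖 (suc k)) ⟩
    sum (map (λ σ → sum (map w (insertions (suc (suc k)) σ))) (𝔖 (suc k)))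
      ≈⟨ sum-cong (All.tabulate (insertions-desAscTerm x y t k)) ⟩
    sum (map (λ σ → t * x * w σ + ∂desAscTerm x y t σ) (𝔖 (suc k)))
      ≈⟨ sum-linear (t * x) w (∂desAscTerm x y t) (𝔖 (suc k)) ⟩
    t * x * desAscSum (suc k) x y t + sum (map (∂desAscTerm x y t) (𝔖 (suc k))) ∎
    where w = desAscTerm x y t

module Derivation (R : CommutativeRing 0ℓ 0ℓ) where

  open import Data.Nat as ℕ using (ℕ; zero; suc; _∸_)
  import Data.Nat.Properties as ℕ
  open import Defs using (peaks; des; asc; LRmin; RLmin)
  open import Data.Product using (_,_; proj₂)
  import Relation.Binary.PropositionalEquality as ≡
  open RingSums R
  open Sides R
  open InsertionRecurrences R
  open DualNumbers R
  private module Sidesᵈ = Sides dualRing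

  fromℕ-2* : ∀ M → fromℕ (2 ℕ.* M) ≈ fromℕ M + fromℕ M
  fromℕ-2* M = trans (fromℕ-homo-+ M (M ℕ.+ 0)) (+-congˡ (reflexive (≡.cong fromℕ (ℕ.+-identityʳ M))))

  module _ (half : Carrier) (half+half≈1 : half + half ≈ 1#) (x y α β : Carrier) where

    private
      u = x * y
      h = (x + y) * half
      u′ = x * (x * y) + (x * y) * y
      h′ = (x + y) * 0# + (x * y + x * y) * half

      u′≈ : u′ ≈ u * (h + h)
      u′≈ = trans (solve 2 (λ x y → x :* (x :* y) :+ (x :* y) :* y := (x :* y) :* (x :+ y)) refl x y)
                  (*-congˡ (trans (sym (trans (*-congˡ half+half≈1) (*-identityʳ _))) (distribˡ (x + y) half half)))

      h′≈ : h′ ≈ u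
      h′≈ = trans (+-cong (zeroʳ _) (distribʳ half u u))
                  (trans (+-identityˡ _) (trans (sym (distribˡ u half half)) (trans (*-congˡ half+half≈1) (*-identityʳ u))))

      ^-tangent-u : ∀ M H → ^-tangent u u′ M * H ≈ fromℕ (2 ℕ.* M) * h * (u ^ M * H)
      ^-tangent-u zero H = trans (zeroˡ H) (sym (trans (*-congʳ (zeroˡ h)) (zeroˡ _)))
      ^-tangent-u (suc m) H =
        trans (*-congʳ (*-congˡ u′≈))
              (trans (solve 5 (λ c P u h H → c :* P :* (u :* (h :+ h)) :* H := (c :+ c) :* h :* (u :* P :* H)) refl
                              (fromℕ (suc m)) (u ^ m) u h H)
                     (*-congʳ (*-congʳ (sym (fromℕ-2* (suc m))))))

      ^-tangent-h : ∀ M E → u ^ M * ^-tangent h h′ E ≈ fromℕ E * (u ^ suc M * h ^ (E ∸ 1))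
      ^-tangent-h M zero = trans (zeroʳ _) (sym (zeroˡ _))
      ^-tangent-h M (suc k) =
        trans (*-congˡ (*-congˡ h′≈))
              (solve 4 (λ U c P u → U :* (c :* P :* u) := c :* (u :* U :* P)) refl (u ^ M) (fromℕ (suc k)) (h ^ k) u)

    ∂peakTerm-dual : ∀ n σ →
      proj₂ (Sidesᵈ.peakTerm (half , 0#) n (x , x * y) (y , x * y) (α , 0#) (β , 0#) σ) ≈ ∂peakTerm half x y α β n σ
    ∂peakTerm-dual n σ
      with _ , ∂ ← *ᵈ-cong (*ᵈ-cong (*ᵈ-cong (^ᵈ u u′ (peaks σ)) (^ᵈ h h′ (n ∸ 2 ℕ.* peaks σ)))
                                    (^ᵈ α 0# (LRmin σ ∸ 1)))
                           (^ᵈ β 0# (RLmin σ ∸ 1)) =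
      trans ∂ (trans (+-cong (*-congˡ (^-tangent-0 β (RLmin σ ∸ 1) refl))
                             (*-congʳ (+-congʳ (*-congˡ (^-tangent-0 α (LRmin σ ∸ 1) refl)))))
              (trans (solve 6 (λ U H aL bR U′ H′ →
                        U :* H :* aL :* con 0 :+ (U :* H :* con 0 :+ (U :* H′ :+ U′ :* H) :* aL) :* bR
                        := (U :* H′ :+ U′ :* H) :* aL :* bR) refl _ _ _ _ _ _)
                     (*-congʳ (*-congʳ (trans (+-comm _ _)
                        (+-cong (^-tangent-u (peaks σ) _) (^-tangent-h (peaks σ) (n ∸ 2 ℕ.* peaks σ))))))))

  module _ (x y t t′ : Carrier) (t′≈0 : t′ ≈ 0#) where

    ∂desAscTerm-dual : ∀ σ → proj₂ (Sidesᵈ.desAscTerm (x , x * y) (y , x * y) (t , t′) σ) ≈ ∂desAscTerm x y t σ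
    ∂desAscTerm-dual σ
      with _ , ∂ ← *ᵈ-cong (*ᵈ-cong (^ᵈ x (x * y) (suc (des σ))) (^ᵈ y (x * y) (asc σ))) (^ᵈ t t′ (LRmin σ)) =
      trans ∂ (trans (+-congʳ (trans (*-congˡ (^-tangent-0 t (LRmin σ) t′≈0)) (zeroʳ _)))
              (trans (+-identityˡ _)
              (trans (*-congʳ (+-cong (^-tangent-y (asc σ)) (solve 5 (λ c X Y x y → c :* X :* (x :* y) :* Y := c :* y :* ((x :* X) :* Y)) refl
                                                                 (fromℕ (suc (des σ))) (x ^ des σ) (y ^ asc σ) x y)))
                     (solve 7 (λ ca cd x y X Y T → (ca :* x :* (X :* Y) :+ cd :* y :* (X :* Y)) :* T := (cd :* y :+ ca :* x) :* ((X :* Y) :* T))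
                            refl _ _ x y (x ^ suc (des σ)) (y ^ asc σ) (t ^ LRmin σ)))))
      where
      ^-tangent-y : ∀ e → x ^ suc (des σ) * ^-tangent y (x * y) e ≈ fromℕ e * x * (x ^ suc (des σ) * y ^ e)
      ^-tangent-y zero = trans (zeroʳ _) (sym (trans (*-congʳ (zeroˡ x)) (zeroˡ _)))
      ^-tangent-y (suc m) = solve 5 (λ c X P x y → X :* (c :* P :* (x :* y)) := c :* x :* (X :* (y :* P))) refl
                              (fromℕ (suc m)) (x ^ suc (des σ)) (y ^ m) x y

module Induction where

  open import Defs using (𝔖)
  open import Data.Nat using (ℕ; zero; suc)
  open import Data.List using (map)
  open import Data.List.Relation.Unary.All using (tabulate)
  open import Data.Product using (_,_; proj₂)
  open import Function using (_∘_)

  GeneralIdentity : CommutativeRing 0ℓ 0ℓ → ℕ → Set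
  GeneralIdentity R n = ∀ half → half + half ≈ 1# → ∀ x y α β →
    lhs half n x y α β ≈ binomialTransform ((α + β) * (y - x) * half) n (desAscSeq x y (α + β))
    where
    open RingSums R
    open Sides R

  base : ∀ R → GeneralIdentity R 0
  base R half _ x y α β = solve 0 (con 1 :* con 1 :* con 1 :* con 1 :+ con 0 := (con 1 :+ con 0) :* con 1 :* con 1 :+ con 0) refl
    where open RingSums R

  module _ (R : CommutativeRing 0ℓ 0ℓ) where

    open RingSums R
    open Sides R
    open InsertionRecurrences R
    open Derivation R
    open DualNumbers R
    module Sidesᵈ = Sides dualRing

    -- Evaluating at (x + ε xy, y + ε xy) and reading off ε applies the derivation D with D x = D y = xy.
    ∂desAscSeq : Carrier → Carrier → Carrier → ℕ → Carrier
    ∂desAscSeq x y t = proj₂ ∘ Sidesᵈ.desAscSeq (x , x * y) (y , x * y) (t , 0# + 0#)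

    desAscSeq-suc : ∀ x y t k → desAscSeq x y t (suc k) ≈ t * x * desAscSeq x y t k + ∂desAscSeq x y t k
    desAscSeq-suc x y t zero =
      solve 2 (λ x t → x :* con 1 :* con 1 :* (t :* con 1) :+ con 0 := t :* x :* con 1 :+ con 0) refl x t
    desAscSeq-suc x y t (suc k) =
      trans (desAscSum-suc k x y t)
            (+-congˡ (trans (sum-cong {xs = 𝔖 (suc k)} (tabulate (λ {σ} _ → sym (∂desAscTerm-dual x y t (0# + 0#) (+-identityʳ 0#) σ))))
                            (sym (proj₂ (sumᵈ _ (𝔖 (suc k)))))))

    t*h≈s+t*x : ∀ half → half + half ≈ 1# → ∀ x y t → t * ((x + y) * half) ≈ t * (y - x) * half + t * x
    t*h≈s+t*x half half+half≈1 x y t = sym (begin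
      t * (y - x) * half + t * x                     ≈⟨ +-congˡ (trans (sym (*-identityʳ _)) (*-congˡ (sym half+half≈1))) ⟩
      t * (y + - x) * half + t * x * (half + half)   ≈⟨ solve 5 (λ t x y x⁻ h → t :* (y :+ x⁻) :* h :+ t :* x :* (h :+ h)
                                                                     := t :* ((x :+ y) :* h) :+ t :* h :* (x :+ x⁻)) refl t x y (- x) half ⟩
      t * ((x + y) * half) + t * half * (x + - x)    ≈⟨ +-congˡ (trans (*-congˡ (-‿inverseʳ x)) (zeroʳ _)) ⟩
      t * ((x + y) * half) + 0#                      ≈⟨ +-identityʳ _ ⟩
      t * ((x + y) * half)                           ∎)

    sum-∂peakTerm : ∀ n → GeneralIdentity dualRing n → ∀ half → half + half ≈ 1# → ∀ x y α β →
      sum (map (∂peakTerm half x y α β n) (𝔖 (suc n))) ≈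
        binomialTransform ((α + β) * (y - x) * half) n (∂desAscSeq x y (α + β))
    sum-∂peakTerm n ihᵈ half half+half≈1 x y α β = begin
      sum (map (∂peakTerm half x y α β n) (𝔖 (suc n)))
        ≈⟨ sum-cong {xs = 𝔖 (suc n)} (tabulate (λ {σ} _ → sym (∂peakTerm-dual half half+half≈1 x y α β n σ))) ⟩
      sum (map (proj₂ ∘ Sidesᵈ.peakTerm half′ n x′ y′ α′ β′) (𝔖 (suc n)))
        ≈⟨ proj₂ (sumᵈ _ (𝔖 (suc n))) ⟨
      proj₂ (Sidesᵈ.lhs half′ n x′ y′ α′ β′)
        ≈⟨ proj₂ (ihᵈ half′ (half+half≈1 , +-identityʳ 0#) x′ y′ α′ β′) ⟩
      proj₂ (ᵈ.binomialTransform (s , _) n (Sidesᵈ.desAscSeq x′ y′ (t , 0# + 0#)))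
        ≈⟨ binomialTransform-tangent s s′≈0 n (Sidesᵈ.desAscSeq x′ y′ (t , 0# + 0#)) ⟩
      binomialTransform s n (∂desAscSeq x y t) ∎
      where
      t = α + β
      s = t * (y - x) * half
      half′ = (half , 0#)
      x′ = (x , x * y)
      y′ = (y , x * y)
      α′ = (α , 0#)
      β′ = (β , 0#)
      s′≈0 : t * (y - x) * 0# + (t * (x * y - x * y) + (0# + 0#) * (y - x)) * half ≈ 0#
      s′≈0 = trans (+-cong (zeroʳ _) (*-congʳ (+-cong (trans (*-congˡ (-‿inverseʳ (x * y))) (zeroʳ t))
                                                      (trans (*-congʳ (+-identityʳ 0#)) (zeroˡ _)))))
                   (trans (+-identityˡ _) (trans (*-congʳ (+-identityʳ 0#)) (zeroˡ half)))

    step : ∀ n → GeneralIdentity R n → GeneralIdentity dualRing n → GeneralIdentity R (suc n)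
    step n ih ihᵈ half half+half≈1 x y α β = begin
      lhs half (suc n) x y α β
        ≈⟨ lhs-suc half n x y α β ⟩
      t * h * lhs half n x y α β + sum (map (∂peakTerm half x y α β n) (𝔖 (suc n)))
        ≈⟨ +-cong (*-congˡ (ih half half+half≈1 x y α β)) (sum-∂peakTerm n ihᵈ half half+half≈1 x y α β) ⟩
      t * h * Q + binomialTransform s n (∂desAscSeq x y t)
        ≈⟨ +-congʳ (*-congʳ (t*h≈s+t*x half half+half≈1 x y t)) ⟩
      (s + t * x) * Q + binomialTransform s n (∂desAscSeq x y t)
        ≈⟨ solve 4 (λ s tx Q D → (s :+ tx) :* Q :+ D := s :* Q :+ (tx :* Q :+ D)) refl s (t * x) Q _ ⟩
      s * Q + (t * x * Q + binomialTransform s n (∂desAscSeq x y t))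
        ≈⟨ +-congˡ (binomialTransform-linear s n (t * x) (desAscSeq-suc x y t)) ⟨
      s * Q + binomialTransform s n (desAscSeq x y t ∘ suc)
        ≈⟨ binomialTransform-suc s n (desAscSeq x y t) ⟨
      binomialTransform s (suc n) (desAscSeq x y t) ∎
      where
      t = α + β
      h = (x + y) * half
      s = t * (y - x) * half
      Q = binomialTransform s n (desAscSeq x y t)

  generalIdentity : ∀ n R → GeneralIdentity R n
  generalIdentity zero R = base R
  generalIdentity (suc n) R = step R n (generalIdentity n R) (generalIdentity n (DualNumbers.dualRing R))

open import Defs using (LHS; RHS; ℕ→ℚ; ½; sumℚ; inner; peaks; des; asc; LRmin; RLmin; 𝔖)
import Defs
open import Data.Nat as ℕ using (ℕ; zero; suc; _≥_; _∸_)
open import Data.Nat.Combinatorics using (_C_)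
open import Data.Nat.Coprimality using (1-coprimeTo) renaming (sym to coprime-sym)
open import Data.Integer as ℤ using (+_)
import Data.Integer.Properties as ℤ
open import Data.Rational as ℚ using (ℚ; mkℚ; 1ℚ)
import Data.Rational.Properties as ℚ
import Data.Rational.Unnormalised as ℚᵘ
import Data.Rational.Unnormalised.Properties as ℚᵘ
open import Data.List using (applyUpTo)
open import Data.List.Properties using (map-cong)
open import Relation.Binary.PropositionalEquality

private
  module ℚRing = RingSums ℚ.+-*-commutativeRing
  module ℚSides = Sides ℚ.+-*-commutativeRing

  ℕ→ℚ-suc : ∀ m → ℕ→ℚ (suc m) ≡ 1ℚ ℚ.+ ℕ→ℚ m
  ℕ→ℚ-suc m = begin
    ℕ→ℚ (suc m)       ≡⟨ normal (suc m) ⟩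
    ι (suc m)         ≡⟨ ℚ.toℚᵘ-injective (ℚᵘ.≃-trans (ℚᵘ.*≡* cross) (ℚᵘ.≃-sym (ℚ.toℚᵘ-homo-+ 1ℚ (ι m)))) ⟩
    1ℚ ℚ.+ ι m        ≡⟨ cong (1ℚ ℚ.+_) (normal m) ⟨
    1ℚ ℚ.+ ℕ→ℚ m      ∎
    where
    open ≡-Reasoning
    ι : ℕ → ℚ
    ι m = mkℚ (+ m) 0 (coprime-sym (1-coprimeTo m))
    normal : ∀ m → ℕ→ℚ m ≡ ι m
    normal m = ℚ.normalize-coprime (coprime-sym (1-coprimeTo m))
    cross : + suc m ℤ.* + 1 ≡ (+ 1 ℤ.+ + m ℤ.* + 1) ℤ.* + 1
    cross = trans (ℤ.*-identityʳ (+ suc m)) (sym (trans (ℤ.*-identityʳ _) (cong (ℤ._+_ (+ 1)) (ℤ.*-identityʳ (+ m)))))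

  ℕ→ℚ≡fromℕ : ∀ m → ℕ→ℚ m ≡ ℚRing.fromℕ m
  ℕ→ℚ≡fromℕ zero = refl
  ℕ→ℚ≡fromℕ (suc m) = trans (ℕ→ℚ-suc m) (cong (1ℚ ℚ.+_) (ℕ→ℚ≡fromℕ m))

  ^≡^ : ∀ q n → q Defs.^ n ≡ q ℚRing.^ n
  ^≡^ q zero = refl
  ^≡^ q (suc n) = cong (q ℚ.*_) (^≡^ q n)

  LHS≡lhs : ∀ n x y α β → LHS n x y α β ≡ ℚSides.lhs ½ n x y α β
  LHS≡lhs n x y α β = cong sumℚ (map-cong (λ σ →
    cong₂ ℚ._*_ (cong₂ ℚ._*_ (cong₂ ℚ._*_ (^≡^ (x ℚ.* y) (peaks σ)) (^≡^ ((x ℚ.+ y) ℚ.* ½) (n ∸ 2 ℕ.* peaks σ)))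
                             (^≡^ α (LRmin σ ∸ 1)))
                (^≡^ β (RLmin σ ∸ 1))) (𝔖 (suc n)))

  inner≡desAscSum : ∀ k x y α β → inner k x y α β ≡ ℚSides.desAscSum k x y (α ℚ.+ β)
  inner≡desAscSum k x y α β = cong sumℚ (map-cong (λ σ →
    cong₂ ℚ._*_ (cong₂ ℚ._*_ (^≡^ x (suc (des σ))) (^≡^ y (asc σ))) (^≡^ (α ℚ.+ β) (LRmin σ))) (𝔖 k))

  RHS≡rhs : ∀ n x y α β → RHS n x y α β ≡ ℚSides.rhs ½ n x y α β
  RHS≡rhs n x y α β = cong₂ ℚ._+_
    (cong sumℚ (map-cong (λ k →
       cong₂ ℚ._*_ (cong₂ ℚ._*_ (cong₂ ℚ._*_ (ℕ→ℚ≡fromℕ (n C k)) (^≡^ ((α ℚ.+ β) ℚ.* (y ℚ.- x)) (n ∸ k)))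
                                (^≡^ ½ (n ∸ k)))
                   (inner≡desAscSum k x y α β)) (applyUpTo suc n)))
    (^≡^ ((α ℚ.+ β) ℚ.* (y ℚ.- x) ℚ.* ½) n)

mainTheorem15 : (n : ℕ) → n ≥ 1 → (x y α β : ℚ) → LHS n x y α β ≡ RHS n x y α β
mainTheorem15 n _ x y α β = begin
  LHS n x y α β              ≡⟨ LHS≡lhs n x y α β ⟩
  ℚSides.lhs ½ n x y α β     ≡⟨ Induction.generalIdentity n ℚ.+-*-commutativeRing ½ refl x y α β ⟩
  ℚRing.binomialTransform ((α ℚ.+ β) ℚ.* (y ℚ.- x) ℚ.* ½) n (ℚSides.desAscSeq x y (α ℚ.+ β))
                             ≡⟨ ℚSides.rhs≈binomialTransform ½ n x y α β ⟨
  ℚSides.rhs ½ n x y α β     ≡⟨ RHS≡rhs n x y α β ⟨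
  RHS n x y α β              ∎
  where open ≡-Reasoning
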